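{- Let $T$ be a tree rooted in a vertex $r$, $\tau$ a threshold function for $T$, $u$ a vertex of $T$ that is not a leaf, with children $v_1,\ldots,v_k$, and $b$ a non-negative integer. Suppose that for every $i\in[k]$ and every non-negative integer $b_i\leq n(T_{v_i})$ there is a set $X\subseteq V(T_{v_i})$ with $|X|=b_i$, ${\rm dyn}(T_{v_i},\tau_X)=x_0(v_i,b_i)$ and ${\rm dyn}(T_{v_i},\tau^{v_i}_X)=x_1(v_i,b_i)$. Then for $j\in\{0,1\}$, $$x_j(u,b)=\max\{z(u,b),z_j(u,b)\},$$ where $$z(u,b)=\max\Big\{1+\sum_{i=1}^k x_1(v_i,b_i):(b_1,\ldots,b_k)\in\mathcal{P}_k(b-1)\Big\},\quad z_j(u,b)=\max\Big\{\delta_j(b_1,\ldots,b_k)+\sum_{i=1}^k x_1(v_i,b_i):(b_1,\ldots,b_k)\in\mathcal{P}_k(b)\Big\},$$ and $\delta_j(b_1,\ldots,b_k)=0$ if $|\{i\in[k]:x_0(v_i,b_i)=x_1(v_i,b_i)\}|\geq\tau(u)-j$ and $\delta_j(b_1,\ldots,b_k)=1$ otherwise. Moreover, if $b\leq n(T_u)$, then there is a set $X\subseteq V(T_u)$ with $|X|=b$ such that ${\rm dyn}(T_u,\tau_X)=x_0(u,b)$ and ${\rm dyn}(T_u,\tau^u_X)=x_1(u,b)$.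
   Context: A threshold function for a graph $G$ is a function $\tau:U\to\mathbb{Z}\cup\{\infty\}$ whose domain $U$ contains $V(G)$. For $D\subseteq V(G)$, the hull $H_{(G,\tau)}(D)$ is the smallest $H\subseteq V(G)$ with $D\subseteq H$ and $u\in H$ for every vertex $u$ with $|H\cap N_G(u)|\geq\tau(u)$; $D$ is a dynamic monopoly if $H_{(G,\tau)}(D)=V(G)$; ${\rm dyn}(G,\tau)$ is the minimum order of a dynamic monopoly. For a set $X$, $\tau_X$ equals $\tau$ on $U\setminus X$ and $\infty$ on $U\cap X$. For a vertex $u$, $\tau^u$ equals $\tau$ except $\tau^u(u)=\tau(u)-1$; $\tau^u_X=(\tau^u)_X$. ${\rm vacc}_1(G,\tau,b)=\max\{{\rm dyn}(G,\tau_X):X\subseteq V(G),|X|=b\}$ with $\max\emptyset=-\infty$; sums involving $-\infty$ equal $-\infty$. $T_u$ is the subtree induced by $u$ and its descendants, $n(T_u)$ its order; $x_0(u,b)={\rm vacc}_1(T_u,\tau,b)$, $x_1(u,b)={\rm vacc}_1(T_u,\tau^u,b)$. $[k]=\{1,\ldots,k\}$ and $\mathcal{P}_k(b)=\{(b_1,\ldots,b_k)\in\mathbb{N}_0^k:b_1+\cdots+b_k=b\}$ (empty if $b<0$). -}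

module Defs where

open import Data.Nat as ℕ using (ℕ; zero; suc; _≤_; _⊓_; _⊔_)
open import Data.Integer as ℤ using (ℤ; +_)
open import Data.Fin using (Fin; zero; suc)
open import Data.Fin.Properties using () renaming (_≟_ to _≟F_)
open import Data.Bool using (Bool; true; false; _∧_; _∨_; not; if_then_else_)
open import Data.List using (List; []; _∷_; map; concat; concatMap; foldr; filterᵇ; length; allFin)
import Data.List as L
open import Data.Product using (_×_; _,_)
open import Relation.Binary.PropositionalEquality using (_≡_; refl)
open import Relation.Nullary using (Dec; yes; no; does)
open import Relation.Nullary.Decidable using (⌊_⌋)

-- Finite rooted trees (rose trees). A vertex of a tree is a position
-- (path from the root).

data Tree : Set where
  node : (k : ℕ) → (Fin k → Tree) → Tree

data Pos : Tree → Set where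
  root  : ∀ {t} → Pos t
  child : ∀ {k f} (i : Fin k) → Pos (f i) → Pos (node k f)

allPos : (t : Tree) → List (Pos t)
allPos (node k f) = root ∷ concatMap (λ i → map (child i) (allPos (f i))) (allFin k)

size : Tree → ℕ
size t = length (allPos t)

sub : (t : Tree) → Pos t → Tree
sub t root = t
sub (node k f) (child i p) = sub (f i) p

ext : {t : Tree} (u : Pos t) → Pos (sub t u) → Pos t
ext root q = q
ext (child i p) q = child i (ext p q)

nch : Tree → ℕ
nch (node k f) = k

childOfRoot : (t : Tree) → Fin (nch t) → Pos t
childOfRoot (node k f) i = child i root

_≟P_ : {t : Tree} → (p q : Pos t) → Bool
root ≟P root = true
root ≟P child _ _ = false
child _ _ ≟P root = false
_≟P_ {node k f} (child i p) (child j q) with i ≟F j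
... | yes refl = p ≟P q
... | no _ = false

isRoot : {t : Tree} → Pos t → Bool
isRoot root = true
isRoot (child _ _) = false

-- (isChild p q) : p is a child of q
isChild : {t : Tree} → Pos t → Pos t → Bool
isChild root q = false
isChild (child i p) root = isRoot p
isChild {node k f} (child i p) (child j q) with i ≟F j
... | yes refl = isChild p q
... | no _ = false

adj : {t : Tree} → Pos t → Pos t → Bool
adj p q = isChild p q ∨ isChild q p

allᵇ : {A : Set} → (A → Bool) → List A → Bool
allᵇ P = foldr (λ a r → P a ∧ r) true

VSet : Tree → Set
VSet t = Pos t → Bool

card : {t : Tree} → VSet t → ℕ
card {t} X = length (filterᵇ (λ p → X p) (allPos t))

_⊆ᵇ_ : {t : Tree} → VSet t → VSet t → Bool
_⊆ᵇ_ {t} X Y = allᵇ (λ p → not (X p) ∨ Y p) (allPos t)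

isFull : {t : Tree} → VSet t → Bool
isFull {t} X = allᵇ X (allPos t)

allFns : (k : ℕ) (A : Fin k → Set) → ((i : Fin k) → List (A i)) → List ((i : Fin k) → A i)
allFns zero A c = (λ ()) ∷ []
allFns (suc k) A c =
  concatMap (λ a → map (λ g → λ { zero → a ; (suc i) → g i })
                       (allFns k (λ i → A (suc i)) (λ i → c (suc i))))
            (c zero)

allSets : (t : Tree) → List (VSet t)
allSets (node k f) =
  concatMap (λ b → map (λ g → λ { root → b ; (child i p) → g i p })
                       (allFns k (λ i → VSet (f i)) (λ i → allSets (f i))))
            (true ∷ false ∷ [])

data Thr : Set where
  fin : ℤ → Thr
  ∞   : Thr

_≥T_ : ℕ → Thr → Bool
n ≥T fin z = z ℤ.≤ᵇ + n
n ≥T ∞ = false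

dec : Thr → Thr
dec (fin z) = fin (z ℤ.- ℤ.1ℤ)
dec ∞ = ∞

Threshold : Tree → Set
Threshold t = Pos t → Thr

_[_]∞ : {t : Tree} → Threshold t → VSet t → Threshold t
(τ [ X ]∞) v = if X v then ∞ else τ v

decAt : {t : Tree} → Pos t → Threshold t → Threshold t
decAt u τ v = if u ≟P v then dec (τ v) else τ v

restrict : {t : Tree} (u : Pos t) → Threshold t → Threshold (sub t u)
restrict u τ q = τ (ext u q)

nbrCount : {t : Tree} → VSet t → Pos t → ℕ
nbrCount {t} H v = length (filterᵇ (λ w → (adj v w ∧ H w)) (allPos t))

closed : {t : Tree} → Threshold t → VSet t → Bool
closed {t} τ H = allᵇ (λ v → not (nbrCount H v ≥T τ v) ∨ H v) (allPos t)

-- D is a dynamic monopoly: the smallest closed superset H_(T,τ)(D) of D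
-- is V(T), i.e. every closed superset of D is the whole vertex set.
isDynMon : {t : Tree} → Threshold t → VSet t → Bool
isDynMon {t} τ D = allᵇ (λ H → not (D ⊆ᵇ H ∧ closed τ H) ∨ isFull H) (allSets t)

-- dyn(T,τ): minimum order of a dynamic monopoly (V(T) is always one,
-- so the list below is non-empty and the start value size t is an upper bound)
dyn : (t : Tree) → Threshold t → ℕ
dyn t τ = foldr _⊓_ (size t) (map card (filterᵇ (λ D → isDynMon τ D) (allSets t)))

data ℕ⁻∞ : Set where
  -∞  : ℕ⁻∞
  val : ℕ → ℕ⁻∞

_⊔E_ : ℕ⁻∞ → ℕ⁻∞ → ℕ⁻∞
-∞ ⊔E y = y
val x ⊔E -∞ = val x
val x ⊔E val y = val (x ⊔ y)

_+E_ : ℕ⁻∞ → ℕ⁻∞ → ℕ⁻∞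
-∞ +E y = -∞
val x +E -∞ = -∞
val x +E val y = val (x ℕ.+ y)

_==E_ : ℕ⁻∞ → ℕ⁻∞ → Bool
-∞ ==E -∞ = true
-∞ ==E val _ = false
val _ ==E -∞ = false
val x ==E val y = does (x ℕ.≟ y)

maxE : List ℕ⁻∞ → ℕ⁻∞
maxE = foldr _⊔E_ -∞

sumE : (k : ℕ) → (Fin k → ℕ⁻∞) → ℕ⁻∞
sumE zero a = val 0
sumE (suc k) a = a zero +E sumE k (λ i → a (suc i))

countFin : (k : ℕ) → (Fin k → Bool) → ℕ
countFin k P = length (filterᵇ (λ i → P i) (allFin k))

vacc₁ : (t : Tree) → Threshold t → ℕ → ℕ⁻∞
vacc₁ t τ b = maxE (map (λ X → val (dyn t (τ [ X ]∞)))
                        (filterᵇ (λ X → does (card X ℕ.≟ b)) (allSets t)))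

x₀ : (T : Tree) → Threshold T → Pos T → ℕ → ℕ⁻∞
x₀ T τ u b = vacc₁ (sub T u) (restrict u τ) b

x₁ : (T : Tree) → Threshold T → Pos T → ℕ → ℕ⁻∞
x₁ T τ u b = vacc₁ (sub T u) (restrict u (decAt u τ)) b

xj : Fin 2 → (T : Tree) → Threshold T → Pos T → ℕ → ℕ⁻∞
xj zero = x₀
xj (suc _) = x₁

decJ : Fin 2 → Thr → Thr
decJ zero θ = θ
decJ (suc _) θ = dec θ

comps : (k : ℕ) → ℕ → List (Fin k → ℕ)
comps zero zero = (λ ()) ∷ []
comps zero (suc b) = []
comps (suc k) b =
  concatMap (λ b₀ → map (λ g → λ { zero → b₀ ; (suc i) → g i }) (comps k (b ℕ.∸ b₀)))
            (L.upTo (suc b))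

compsPred : (k : ℕ) → ℕ → List (Fin k → ℕ)
compsPred k zero = []
compsPred k (suc b) = comps k b

kids : (T : Tree) (u : Pos T) → Fin (nch (sub T u)) → Pos T
kids T u i = ext u (childOfRoot (sub T u) i)

zU : (T : Tree) → Threshold T → Pos T → ℕ → ℕ⁻∞
zU T τ u b = maxE (map (λ bs → val 1 +E sumE (nch (sub T u)) (λ i → x₁ T τ (kids T u i) (bs i)))
                       (compsPred (nch (sub T u)) b))

δ : Fin 2 → (T : Tree) → Threshold T → (u : Pos T) → (Fin (nch (sub T u)) → ℕ) → ℕ
δ j T τ u bs =
  if countFin (nch (sub T u)) (λ i → x₀ T τ (kids T u i) (bs i) ==E x₁ T τ (kids T u i) (bs i))
       ≥T decJ j (τ u)
  then 0 else 1

zJ : Fin 2 → (T : Tree) → Threshold T → Pos T → ℕ → ℕ⁻∞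
zJ j T τ u b = maxE (map (λ bs → val (δ j T τ u bs) +E sumE (nch (sub T u)) (λ i → x₁ T τ (kids T u i) (bs i)))
                         (comps (nch (sub T u)) b))

-- A set D is a dynamic monopoly of a tree with root r exactly when, for every child v of r, the part of D
-- in T_v is a monopoly of T_v with threshold τ^v (r is eventually infected), and either r ∈ D or at least
-- τ(r) of these parts infect their root v without help from r. Hence a minimum monopoly costs
-- Σ_v dyn(T_v, τ^v), plus one unless at least τ(r) children satisfy dyn(T_v, τ) = dyn(T_v, τ^v).
-- Applied to τ_X and τ^r_X, with X split according to whether r ∈ X, this bounds x_j(r, b) by
-- max{z, z_j}, and the hypothesis, which realises x₀ and x₁ of each child by one set, gives equality.
-- A set realising x₀(r, b) and x₁(r, b) at once comes from a maximiser of z if z ≥ z₀; otherwise, as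
-- δ₁ ≤ δ₀ ≤ δ₁ + 1, a maximiser of z₀ or one of z₁ attains both z₀ and z₁.
-- A vertex below the root is the root of its own subtree.

module Submission where

open import Defs

open import Data.Bool using (Bool; true; false; _∧_; _∨_; not; if_then_else_; T)
open import Data.Bool.Properties using (∨-identityʳ; ∧-conicalˡ; ∧-conicalʳ; T-≡)
open import Data.Empty using (⊥-elim)
open import Data.Fin using (Fin; zero; suc)
open import Data.Fin.Properties using (all?; ¬∀⟶∃¬) renaming (suc-injective to Fin-suc-injective; _≟_ to _≟F_)
import Data.Integer as ℤ
import Data.Integer.Properties as ℤₚ
open import Data.List using (List; []; _∷_; map; concatMap; foldr; filterᵇ; length; tabulate; allFin; upTo)
open import Data.List.Properties using (length-++; filter-++; length-filter; map-cong)
open import Data.List.Membership.Propositional using (_∈_; find)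
open import Data.List.Membership.Propositional.Properties
  using (∈-map⁺; ∈-map⁻; ∈-concatMap⁺; ∈-concatMap⁻; ∈-++⁺ˡ; ∈-++⁺ʳ; ∈-allFin; ∈-filter⁺; ∈-filter⁻;
         ∈-upTo⁺; ∈-upTo⁻)
open import Data.List.Relation.Unary.Any as Any using (here; there)
open import Data.Nat using (ℕ; zero; suc; _+_; _∸_; _≤_; _<_; _⊓_; z≤n; s≤s)
open import Data.Nat.Properties
open import Algebra.Properties.Monoid.Sum +-0-monoid using (sum; sum-syntax; sum-cong-≗)
open import Data.Product using (Σ; _×_; ∃; _,_; proj₁; proj₂)
open import Data.Sum using (_⊎_; inj₁; inj₂; [_,_]′)
open import Data.Vec.Functional using (Vector)
open import Function using (_∘_; case_of_)
open import Function.Bundles using (Equivalence)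
open import Relation.Nullary using (does; yes; no)
open import Relation.Nullary.Decidable using (T?; dec-true)
open import Relation.Binary.PropositionalEquality
  using (_≡_; refl; sym; trans; cong; cong₂; subst; subst₂; _≢_; _≗_; module ≡-Reasoning)

false≢true : false ≢ true
false≢true ()

T⇒≡ : ∀ {b} → T b → b ≡ true
T⇒≡ = Equivalence.to T-≡

≡⇒T : ∀ {b} → b ≡ true → T b
≡⇒T = Equivalence.from T-≡

does-≟⁻ : ∀ {m n} → does (m ≟ n) ≡ true → m ≡ n
does-≟⁻ {m} {n} m≟n = ≡ᵇ⇒≡ m n (≡⇒T m≟n)

𝟙 : Bool → ℕ
𝟙 true  = 1
𝟙 false = 0

𝟙≤1 : ∀ b → 𝟙 b ≤ 1
𝟙≤1 true  = ≤-refl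
𝟙≤1 false = z≤n

𝟙-mono : ∀ {a b} → (a ≡ true → b ≡ true) → 𝟙 a ≤ 𝟙 b
𝟙-mono {true}  a⇒b rewrite a⇒b refl = ≤-refl
𝟙-mono {false} _ = z≤n

𝟙-not-anti : ∀ {a b} → (a ≡ true → b ≡ true) → 𝟙 (not b) ≤ 𝟙 (not a)
𝟙-not-anti {true}  a⇒b rewrite a⇒b refl = z≤n
𝟙-not-anti {false} _ = 𝟙≤1 _

if-then-0-else-1 : ∀ c → (if c then 0 else 1) ≡ 𝟙 (not c)
if-then-0-else-1 true  = refl
if-then-0-else-1 false = refl

sum-mono-≤ : ∀ {k} {a b : Vector ℕ k} → (∀ i → a i ≤ b i) → sum a ≤ sum b
sum-mono-≤ {zero}  _   = z≤n
sum-mono-≤ {suc k} a≤b = +-mono-≤ (a≤b zero) (sum-mono-≤ (a≤b ∘ suc))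

sum-mono-< : ∀ {k} {a b : Vector ℕ k} → (∀ i → a i ≤ b i) → ∀ j → a j < b j → sum a < sum b
sum-mono-< a≤b zero    aj<bj = +-mono-<-≤ aj<bj (sum-mono-≤ (a≤b ∘ suc))
sum-mono-< a≤b (suc j) aj<bj = +-mono-≤-< (a≤b zero) (sum-mono-< (a≤b ∘ suc) j aj<bj)

sum-<-or-≗ : ∀ {k} {a b : Vector ℕ k} → (∀ i → a i ≤ b i) → sum a < sum b ⊎ a ≗ b
sum-<-or-≗ {zero}  _   = inj₂ λ ()
sum-<-or-≗ {suc k} a≤b with m≤n⇒m<n∨m≡n (a≤b zero) | sum-<-or-≗ (a≤b ∘ suc)
... | inj₁ lt | _        = inj₁ (sum-mono-< a≤b zero lt)
... | inj₂ eq | inj₁ lt  = inj₁ (+-mono-≤-< (≤-reflexive eq) lt)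
... | inj₂ eq | inj₂ eqs = inj₂ λ { zero → eq ; (suc i) → eqs i }

sum-zero : ∀ {k} {a : Vector ℕ k} → (∀ i → a i ≡ 0) → sum a ≡ 0
sum-zero {zero}  _  = refl
sum-zero {suc k} a0 = cong₂ _+_ (a0 zero) (sum-zero (a0 ∘ suc))

sum-single : ∀ {k} (a : Vector ℕ k) i → (∀ j → j ≢ i → a j ≡ 0) → sum a ≡ a i
sum-single a zero    a0 = trans (cong (a zero +_) (sum-zero λ j → a0 (suc j) λ ())) (+-identityʳ _)
sum-single a (suc i) a0 = trans (cong (_+ sum (a ∘ suc)) (a0 zero λ ()))
                                (sum-single (a ∘ suc) i λ j j≢i → a0 (suc j) (j≢i ∘ Fin-suc-injective))

⇒ᵇ-all-or-counterexample : ∀ {k} (P Q : Fin k → Bool) →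
                           (∀ i → P i ≡ true → Q i ≡ true) ⊎ ∃ λ i → P i ≡ true × Q i ≡ false
⇒ᵇ-all-or-counterexample {zero}  P Q = inj₁ λ ()
⇒ᵇ-all-or-counterexample {suc k} P Q
  with P zero in P0 | Q zero in Q0 | ⇒ᵇ-all-or-counterexample (P ∘ suc) (Q ∘ suc)
... | true  | false | _                  = inj₂ (zero , P0 , Q0)
... | _     | _     | inj₂ (i , Pi , Qi) = inj₂ (suc i , Pi , Qi)
... | true  | true  | inj₁ P⇒Q           = inj₁ λ { zero _ → Q0 ; (suc i) → P⇒Q i }
... | false | _     | inj₁ P⇒Q           = inj₁ λ { zero P0≡true → ⊥-elim (false≢true (trans (sym P0) P0≡true))
                                                  ; (suc i) → P⇒Q i }

count-mono : ∀ {k} {P Q : Fin k → Bool} → (∀ i → P i ≡ true → Q i ≡ true) →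
             ∑[ i < k ] 𝟙 (P i) ≤ ∑[ i < k ] 𝟙 (Q i)
count-mono P⇒Q = sum-mono-≤ λ i → 𝟙-mono (P⇒Q i)

exchange : ∀ {p₀ p₁ q₀ q₁} → p₁ ≤ p₀ → q₀ ≤ q₁ → p₀ ≤ suc q₀ → q₁ ≤ p₁ → p₁ ≡ p₀ ⊎ q₀ ≡ q₁
exchange p₁≤p₀ q₀≤q₁ p₀≤1+q₀ q₁≤p₁ with m≤n⇒m<n∨m≡n p₁≤p₀ | m≤n⇒m<n∨m≡n q₀≤q₁
... | inj₂ p₁≡p₀ | _          = inj₁ p₁≡p₀
... | inj₁ _     | inj₂ q₀≡q₁ = inj₂ q₀≡q₁
... | inj₁ p₁<p₀ | inj₁ q₀<q₁ =
  ⊥-elim (<-irrefl refl (<-≤-trans p₁<p₀ (≤-trans p₀≤1+q₀ (≤-trans q₀<q₁ q₁≤p₁))))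

private variable A B : Set

length-filterᵇ-∷ : ∀ (p : A → Bool) x xs → length (filterᵇ p (x ∷ xs)) ≡ 𝟙 (p x) + length (filterᵇ p xs)
length-filterᵇ-∷ p x xs with p x
... | true  = refl
... | false = refl

length-filterᵇ-cong : ∀ {p q : A → Bool} → p ≗ q → ∀ xs → length (filterᵇ p xs) ≡ length (filterᵇ q xs)
length-filterᵇ-cong p≗q []       = refl
length-filterᵇ-cong {p = p} {q} p≗q (x ∷ xs) = begin
  length (filterᵇ p (x ∷ xs))          ≡⟨ length-filterᵇ-∷ p x xs ⟩
  𝟙 (p x) + length (filterᵇ p xs)      ≡⟨ cong₂ _+_ (cong 𝟙 (p≗q x)) (length-filterᵇ-cong p≗q xs) ⟩
  𝟙 (q x) + length (filterᵇ q xs)      ≡⟨ length-filterᵇ-∷ q x xs ⟨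
  length (filterᵇ q (x ∷ xs))          ∎
  where open ≡-Reasoning

length-filterᵇ-true : ∀ (xs : List A) → length (filterᵇ (λ _ → true) xs) ≡ length xs
length-filterᵇ-true []       = refl
length-filterᵇ-true (x ∷ xs) = cong suc (length-filterᵇ-true xs)

length-filterᵇ-map : ∀ (p : B → Bool) (g : A → B) xs →
                     length (filterᵇ p (map g xs)) ≡ length (filterᵇ (p ∘ g) xs)
length-filterᵇ-map p g []       = refl
length-filterᵇ-map p g (x ∷ xs) =
  trans (length-filterᵇ-∷ p (g x) (map g xs))
        (trans (cong (𝟙 (p (g x)) +_) (length-filterᵇ-map p g xs)) (sym (length-filterᵇ-∷ (p ∘ g) x xs)))

length-filterᵇ-tabulate : ∀ (p : A → Bool) {k} (h : Fin k → A) →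
                          length (filterᵇ p (tabulate h)) ≡ ∑[ i < k ] 𝟙 (p (h i))
length-filterᵇ-tabulate p {zero}  h = refl
length-filterᵇ-tabulate p {suc k} h =
  trans (length-filterᵇ-∷ p (h zero) _) (cong (𝟙 (p (h zero)) +_) (length-filterᵇ-tabulate p (h ∘ suc)))

countFin≡sum : ∀ k (P : Fin k → Bool) → countFin k P ≡ ∑[ i < k ] 𝟙 (P i)
countFin≡sum k P = length-filterᵇ-tabulate P (λ i → i)

length-filterᵇ-concatMap : ∀ (p : A → Bool) {k} (g : Fin k → List A) →
  length (filterᵇ p (concatMap g (allFin k))) ≡ ∑[ i < k ] length (filterᵇ p (g i))
length-filterᵇ-concatMap {A = A} p g = go g (λ i → i)
  where
  go : ∀ {k} {C : Set} (g : C → List A) (h : Fin k → C) →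
       length (filterᵇ p (concatMap g (tabulate h))) ≡ ∑[ i < k ] length (filterᵇ p (g (h i)))
  go {zero}  g h = refl
  go {suc k} g h = trans (cong length (filter-++ (T? ∘ p) (g (h zero)) _))
                   (trans (length-++ (filterᵇ p (g (h zero))))
                          (cong (length (filterᵇ p (g (h zero))) +_) (go g (h ∘ suc))))

length-filterᵇ-false : ∀ (xs : List A) → length (filterᵇ (λ _ → false) xs) ≡ 0
length-filterᵇ-false []       = refl
length-filterᵇ-false (x ∷ xs) = length-filterᵇ-false xs

allᵇ-true⁻ : ∀ (P : A → Bool) {xs} → allᵇ P xs ≡ true → ∀ {x} → x ∈ xs → P x ≡ true
allᵇ-true⁻ P {y ∷ _} all (here refl) with P y
... | true = refl
allᵇ-true⁻ P {y ∷ _} all (there x∈) with P y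
... | true = allᵇ-true⁻ P all x∈

allᵇ-true⁺ : ∀ (P : A → Bool) xs → (∀ {x} → x ∈ xs → P x ≡ true) → allᵇ P xs ≡ true
allᵇ-true⁺ P []       _   = refl
allᵇ-true⁺ P (y ∷ xs) all rewrite all (here refl) = allᵇ-true⁺ P xs (all ∘ there)

allᵇ-false⁻ : ∀ (P : A → Bool) xs → allᵇ P xs ≡ false → ∃ λ x → x ∈ xs × P x ≡ false
allᵇ-false⁻ P (y ∷ xs) some with P y in Py
... | true  = let x , x∈ , Px = allᵇ-false⁻ P xs some in x , there x∈ , Px
... | false = y , here refl , Py

⇒ᵇ-true⁻ : ∀ a b → not a ∨ b ≡ true → a ≡ true → b ≡ true
⇒ᵇ-true⁻ true b a⇒b refl = a⇒b

⇒ᵇ-true⁺ : ∀ a b → (a ≡ true → b ≡ true) → not a ∨ b ≡ true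
⇒ᵇ-true⁺ true  b a⇒b = a⇒b refl
⇒ᵇ-true⁺ false b _   = refl

∈-allPos : ∀ {t} (p : Pos t) → p ∈ allPos t
∈-allPos {node _ _} root  = here refl
∈-allPos (child i p) =
  there (∈-concatMap⁺ _ (Any.map (λ { refl → ∈-map⁺ (child i) (∈-allPos p) }) (∈-allFin i)))

allFns-complete : ∀ k {A : Fin k → Set} (c : ∀ i → List (A i)) (_≈_ : ∀ {i} → A i → A i → Set)
                  (g : ∀ i → A i) → (∀ i → ∃ λ a → a ∈ c i × a ≈ g i) →
                  ∃ λ g′ → g′ ∈ allFns k A c × (∀ i → g′ i ≈ g i)
allFns-complete zero    c _≈_ g g∈ = _ , here refl , λ ()
allFns-complete (suc k) c _≈_ g g∈ with g∈ zero | allFns-complete k (c ∘ suc) _≈_ (g ∘ suc) (g∈ ∘ suc)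
... | a , a∈ , a≈ | g′ , g′∈ , g′≈ =
  _ , ∈-concatMap⁺ _ (Any.map (λ { refl → ∈-map⁺ _ g′∈ }) a∈) , λ { zero → a≈ ; (suc i) → g′≈ i }

allSets-complete : ∀ t (X : VSet t) → ∃ λ X′ → X′ ∈ allSets t × X′ ≗ X
allSets-complete (node k f) X
  with allFns-complete k (λ i → allSets (f i)) _≗_ (λ i → X ∘ child i) (λ i → allSets-complete (f i) (X ∘ child i))
... | g , g∈ , g≗ with X root in Xr
... | true  = _ , ∈-++⁺ˡ (∈-map⁺ _ g∈) , λ { root → sym Xr ; (child i q) → g≗ i q }
... | false = _ , ∈-++⁺ʳ (map _ (allFns k (λ i → VSet (f i)) (λ i → allSets (f i)))) (∈-++⁺ˡ (∈-map⁺ _ g∈))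
                , λ { root → sym Xr ; (child i q) → g≗ i q }

length-filterᵇ-allPos-node : ∀ {k f} (p : Pos (node k f) → Bool) →
  length (filterᵇ p (allPos (node k f))) ≡ 𝟙 (p root) + ∑[ i < k ] length (filterᵇ (p ∘ child i) (allPos (f i)))
length-filterᵇ-allPos-node {k} {f} p =
  trans (length-filterᵇ-∷ p root _)
        (cong (𝟙 (p root) +_) (trans (length-filterᵇ-concatMap p (λ i → map (child i) (allPos (f i))))
                                     (sum-cong-≗ λ i → length-filterᵇ-map p (child i) (allPos (f i)))))

card-node : ∀ {k f} (X : VSet (node k f)) → card X ≡ 𝟙 (X root) + ∑[ i < k ] card (X ∘ child i)
card-node = length-filterᵇ-allPos-node

card-cong : ∀ {t} {X Y : VSet t} → X ≗ Y → card X ≡ card Y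
card-cong {t} X≗Y = length-filterᵇ-cong X≗Y (allPos t)

card≤size : ∀ {t} (X : VSet t) → card X ≤ size t
card≤size {t} X = length-filter (T? ∘ X) (allPos t)

card-full : ∀ t → card {t} (λ _ → true) ≡ size t
card-full t = length-filterᵇ-true (allPos t)

size-node : ∀ k f → size (node k f) ≡ suc (∑[ i < k ] size (f i))
size-node k f = begin
  size (node k f)                              ≡⟨ card-full (node k f) ⟨
  card {node k f} (λ _ → true)                 ≡⟨ card-node {k} {f} (λ _ → true) ⟩
  suc (∑[ i < k ] card {f i} (λ _ → true))     ≡⟨ cong suc (sum-cong-≗ λ i → card-full (f i)) ⟩
  suc (∑[ i < k ] size (f i))                  ∎
  where open ≡-Reasoning

card-root-only : ∀ t (G : VSet t) → length (filterᵇ (λ q → isRoot q ∧ G q) (allPos t)) ≡ 𝟙 (G root)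
card-root-only (node k f) G =
  trans (length-filterᵇ-allPos-node (λ q → isRoot q ∧ G q))
        (trans (cong (𝟙 (G root) +_) (sum-zero λ i → length-filterᵇ-false (allPos (f i)))) (+-identityʳ _))

nbrCount-root : ∀ {k f} (H : VSet (node k f)) → nbrCount H root ≡ ∑[ i < k ] 𝟙 (H (child i root))
nbrCount-root {k} {f} H =
  trans (length-filterᵇ-allPos-node (λ w → adj root w ∧ H w))
        (sum-cong-≗ λ i → card-root-only (f i) (H ∘ child i))

isChild-child-≡ : ∀ {k f} (i : Fin k) (p q : Pos (f i)) → isChild {node k f} (child i p) (child i q) ≡ isChild p q
isChild-child-≡ i p q with i ≟F i
... | yes refl = refl
... | no i≢i   = ⊥-elim (i≢i refl)

isChild-child-≢ : ∀ {k f} {i j : Fin k} (p : Pos (f i)) (q : Pos (f j)) → i ≢ j →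
                  isChild {node k f} (child i p) (child j q) ≡ false
isChild-child-≢ {i = i} {j} p q i≢j with i ≟F j
... | yes refl = ⊥-elim (i≢j refl)
... | no _     = refl

nbrCount-child : ∀ {k f} (H : VSet (node k f)) i (p : Pos (f i)) →
                 nbrCount H (child i p) ≡ 𝟙 (isRoot p ∧ H root) + nbrCount (H ∘ child i) p
nbrCount-child {k} {f} H i p =
  trans (length-filterᵇ-allPos-node P)
        (cong₂ _+_ (cong (λ b → 𝟙 (b ∧ H root)) (∨-identityʳ (isRoot p)))
                   (trans (sum-single _ i other-subtrees-empty) own-subtree))
  where
  P : VSet (node k f)
  P w = adj (child i p) w ∧ H w
  other-subtrees-empty : ∀ j → j ≢ i → length (filterᵇ (P ∘ child j) (allPos (f j))) ≡ 0
  other-subtrees-empty j j≢i =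
    trans (length-filterᵇ-cong (λ q → cong (_∧ H (child j q))
                                            (cong₂ _∨_ (isChild-child-≢ p q (j≢i ∘ sym)) (isChild-child-≢ q p j≢i)))
                               (allPos (f j)))
          (length-filterᵇ-false (allPos (f j)))
  own-subtree : length (filterᵇ (P ∘ child i) (allPos (f i))) ≡ nbrCount (H ∘ child i) p
  own-subtree = length-filterᵇ-cong (λ q → cong (_∧ H (child i q))
                                      (cong₂ _∨_ (isChild-child-≡ i p q) (isChild-child-≡ i q p))) (allPos (f i))

-- Dynamic monopolies

≥T-suc : ∀ n θ → (suc n ≥T θ) ≡ (n ≥T dec θ)
≥T-suc n ∞                        = refl
≥T-suc n (fin ℤ.-[1+ m ])         = refl
≥T-suc n (fin (ℤ.+ zero))           = refl
≥T-suc n (fin (ℤ.+ suc zero))       = refl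
≥T-suc n (fin (ℤ.+ suc (suc m)))    = refl

≥T-mono : ∀ {m n} θ → m ≤ n → (m ≥T θ) ≡ true → (n ≥T θ) ≡ true
≥T-mono (fin z) m≤n m≥z =
  T⇒≡ (ℤₚ.≤⇒≤ᵇ {i = z} (ℤₚ.≤-trans (ℤₚ.≤ᵇ⇒≤ {i = z} (≡⇒T m≥z)) (ℤ.+≤+ m≤n)))

≥T-dec : ∀ n θ → (n ≥T θ) ≡ true → (n ≥T dec θ) ≡ true
≥T-dec n θ n≥θ = trans (sym (≥T-suc n θ)) (≥T-mono θ (n≤1+n n) n≥θ)

module _ {t : Tree} where

  infix 4 _⊆_

  _⊆_ : VSet t → VSet t → Set
  D ⊆ H = ∀ v → D v ≡ true → H v ≡ true

  Full : VSet t → Set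
  Full H = ∀ v → H v ≡ true

  Closed : Threshold t → VSet t → Set
  Closed θ H = ∀ v → (nbrCount H v ≥T θ v) ≡ true → H v ≡ true

  DynMon : Threshold t → VSet t → Set
  DynMon θ D = ∀ H → D ⊆ H → Closed θ H → Full H

  closed-true⁻ : ∀ θ H → closed θ H ≡ true → Closed θ H
  closed-true⁻ θ H cl v = ⇒ᵇ-true⁻ _ _ (allᵇ-true⁻ _ cl (∈-allPos v))

  closed-true⁺ : ∀ θ H → Closed θ H → closed θ H ≡ true
  closed-true⁺ θ H cl = allᵇ-true⁺ _ (allPos t) λ {v} _ → ⇒ᵇ-true⁺ _ _ (cl v)

  ⊆ᵇ-true⁻ : ∀ D H → (D ⊆ᵇ H) ≡ true → D ⊆ H
  ⊆ᵇ-true⁻ D H D⊆H v = ⇒ᵇ-true⁻ _ _ (allᵇ-true⁻ _ D⊆H (∈-allPos v))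

  ⊆ᵇ-true⁺ : ∀ D H → D ⊆ H → (D ⊆ᵇ H) ≡ true
  ⊆ᵇ-true⁺ D H D⊆H = allᵇ-true⁺ _ (allPos t) λ {v} _ → ⇒ᵇ-true⁺ _ _ (D⊆H v)

  isFull-true⁻ : ∀ H → isFull H ≡ true → Full H
  isFull-true⁻ H full v = allᵇ-true⁻ H full (∈-allPos v)

  isFull-true⁺ : ∀ H → Full H → isFull H ≡ true
  isFull-true⁺ H full = allᵇ-true⁺ H (allPos t) λ {v} _ → full v

  Closed-resp-≗ : ∀ θ {H H′} → H ≗ H′ → Closed θ H → Closed θ H′
  Closed-resp-≗ θ {H} {H′} H≗H′ cl v n≥θ =
    trans (sym (H≗H′ v)) (cl v (subst (λ n → (n ≥T θ v) ≡ true) nbr≡ n≥θ))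
    where
    nbr≡ : nbrCount H′ v ≡ nbrCount H v
    nbr≡ = length-filterᵇ-cong (λ w → cong (adj v w ∧_) (sym (H≗H′ w))) (allPos t)

  Closed-cong : ∀ {θ θ′} H → θ ≗ θ′ → Closed θ H → Closed θ′ H
  Closed-cong H θ≗θ′ cl v n≥θ′ =
    cl v (subst (λ θv → (nbrCount H v ≥T θv) ≡ true) (sym (θ≗θ′ v)) n≥θ′)

  DynMon-cong : ∀ {θ θ′} D → θ ≗ θ′ → DynMon θ D → DynMon θ′ D
  DynMon-cong D θ≗θ′ dm H D⊆H cl = dm H D⊆H (Closed-cong H (sym ∘ θ≗θ′) cl)

  DynMon-resp-≗ : ∀ θ {D D′} → D ≗ D′ → DynMon θ D → DynMon θ D′
  DynMon-resp-≗ θ D≗D′ dm H D′⊆H = dm H λ v Dv → D′⊆H v (trans (sym (D≗D′ v)) Dv)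

  isDynMon-true⁻ : ∀ θ D → isDynMon θ D ≡ true → DynMon θ D
  isDynMon-true⁻ θ D dm H D⊆H cl v with allSets-complete t H
  ... | H′ , H′∈ , H′≗H =
    trans (sym (H′≗H v))
          (isFull-true⁻ H′ (⇒ᵇ-true⁻ _ _ (allᵇ-true⁻ _ dm H′∈)
             (cong₂ _∧_ (⊆ᵇ-true⁺ D H′ λ w Dw → trans (H′≗H w) (D⊆H w Dw))
                        (closed-true⁺ θ H′ (Closed-resp-≗ θ (sym ∘ H′≗H) cl))))
                        v)

  isDynMon-true⁺ : ∀ θ D → DynMon θ D → isDynMon θ D ≡ true
  isDynMon-true⁺ θ D dm = allᵇ-true⁺ _ (allSets t) λ {H} _ → ⇒ᵇ-true⁺ _ _ λ D⊆H∧cl →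
    isFull-true⁺ H (dm H (⊆ᵇ-true⁻ D H (∧-conicalˡ _ _ D⊆H∧cl))
                         (closed-true⁻ θ H (∧-conicalʳ _ _ D⊆H∧cl)))

  isDynMon-false⁻ : ∀ θ D → isDynMon θ D ≡ false →
                    ∃ λ H → D ⊆ H × Closed θ H × ∃ λ v → H v ≡ false
  isDynMon-false⁻ θ D not-dm with allᵇ-false⁻ _ (allSets t) not-dm
  ... | H , _ , counterexample with (D ⊆ᵇ H) in D⊆H | closed θ H in cl | isFull H in full
  ... | true  | true  | false = H , ⊆ᵇ-true⁻ D H D⊆H , closed-true⁻ θ H cl ,
                                 let v , _ , Hv = allᵇ-false⁻ H (allPos t) full in v , Hv
  ... | true  | true  | true  with () ← counterexample
  ... | true  | false | _     with () ← counterexample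
  ... | false | _     | _     with () ← counterexample

foldr-⊓-≤ : ∀ s xs {x} → x ∈ xs → foldr _⊓_ s xs ≤ x
foldr-⊓-≤ s (y ∷ xs) (here refl) = m⊓n≤m y _
foldr-⊓-≤ s (y ∷ xs) (there x∈) = ≤-trans (m⊓n≤n y _) (foldr-⊓-≤ s xs x∈)

foldr-⊓-attained : ∀ s xs → foldr _⊓_ s xs ≡ s ⊎ foldr _⊓_ s xs ∈ xs
foldr-⊓-attained s []       = inj₁ refl
foldr-⊓-attained s (y ∷ xs) with ⊓-sel y (foldr _⊓_ s xs) | foldr-⊓-attained s xs
... | inj₁ min≡y | _         = inj₂ (here min≡y)
... | inj₂ min≡m | inj₁ m≡s  = inj₁ (trans min≡m m≡s)
... | inj₂ min≡m | inj₂ m∈xs = inj₂ (there (subst (_∈ xs) (sym min≡m) m∈xs))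

module _ {t : Tree} where

  dyn-minimal : ∀ θ D → DynMon θ D → dyn t θ ≤ card D
  dyn-minimal θ D dm with allSets-complete t D
  ... | D′ , D′∈ , D′≗D =
    subst (dyn t θ ≤_) (card-cong D′≗D) (foldr-⊓-≤ (size t) _ (∈-map⁺ card (∈-filter⁺ _ D′∈ (≡⇒T D′-dynMon))))
    where
    D′-dynMon : isDynMon θ D′ ≡ true
    D′-dynMon = isDynMon-true⁺ θ D′ (DynMon-resp-≗ θ (sym ∘ D′≗D) dm)

  dyn-attained : ∀ θ → ∃ λ D → DynMon θ D × card D ≡ dyn t θ
  dyn-attained θ with foldr-⊓-attained (size t) (map card (filterᵇ (isDynMon θ) (allSets t)))
  ... | inj₁ dyn≡size = (λ _ → true) , (λ H V⊆H _ v → V⊆H v refl) , trans (card-full t) (sym dyn≡size)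
  ... | inj₂ dyn∈ with ∈-map⁻ card dyn∈
  ... | D , D∈ , dyn≡ =
    D , isDynMon-true⁻ θ D (T⇒≡ (proj₂ (∈-filter⁻ _ {xs = allSets t} D∈))) , sym dyn≡

  dyn-cong : ∀ {θ θ′} → θ ≗ θ′ → dyn t θ ≡ dyn t θ′
  dyn-cong {θ} {θ′} θ≗θ′ with dyn-attained θ | dyn-attained θ′
  ... | D , dm , cardD | D′ , dm′ , cardD′ =
    ≤-antisym (subst (dyn t θ ≤_) cardD′ (dyn-minimal θ D′ (DynMon-cong D′ (sym ∘ θ≗θ′) dm′)))
              (subst (dyn t θ′ ≤_) cardD (dyn-minimal θ′ D (DynMon-cong D θ≗θ′ dm)))

  Closed-decAt-root⁻ : ∀ (σ : Threshold t) H → Closed (decAt root σ) H → Closed σ H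
  Closed-decAt-root⁻ σ H cl root        n≥σ = cl root (≥T-dec _ (σ root) n≥σ)
  Closed-decAt-root⁻ σ H cl (child i p) n≥σ = cl (child i p) n≥σ

  DynMon-decAt-root : ∀ (σ : Threshold t) D → DynMon σ D → DynMon (decAt root σ) D
  DynMon-decAt-root σ D dm H D⊆H cl = dm H D⊆H (Closed-decAt-root⁻ σ H cl)

  dyn-decAt-root-≤ : ∀ (σ : Threshold t) → dyn t (decAt root σ) ≤ dyn t σ
  dyn-decAt-root-≤ σ with dyn-attained σ
  ... | D , dm , cardD =
    subst (dyn t (decAt root σ) ≤_) cardD (dyn-minimal (decAt root σ) D (DynMon-decAt-root σ D dm))

  Closed-decAt-root⁺ : ∀ (σ : Threshold t) H → H root ≡ true → Closed σ H → Closed (decAt root σ) H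
  Closed-decAt-root⁺ σ H Hr cl root        _   = Hr
  Closed-decAt-root⁺ σ H Hr cl (child i p) n≥σ = cl (child i p) n≥σ

  closed-superset-with-root≡isDynMon : ∀ (σ : Threshold t) D → DynMon (decAt root σ) D →
                                       ∃ λ H → D ⊆ H × Closed σ H × H root ≡ isDynMon σ D
  closed-superset-with-root≡isDynMon σ D dm⁻ with isDynMon σ D in mon
  ... | true  = (λ _ → true) , (λ _ _ → refl) , (λ _ _ → refl) , refl
  ... | false with isDynMon-false⁻ σ D mon
  ... | H , D⊆H , cl , v , Hv≡false with H root in Hr
  ...   | false = H , D⊆H , cl , Hr
  ...   | true  with () ← trans (sym (dm⁻ H D⊆H (Closed-decAt-root⁺ σ H Hr cl) v)) Hv≡false

-- The minimum dynamic monopoly at a node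

decAt-root-if : ∀ {t} → Bool → Threshold t → Threshold t
decAt-root-if true  θ = decAt root θ
decAt-root-if false θ = θ

Closed-decAt-root-if⁻ : ∀ {t} b (θ : Threshold t) H → Closed (decAt-root-if b θ) H → Closed θ H
Closed-decAt-root-if⁻ true  θ H cl = Closed-decAt-root⁻ θ H cl
Closed-decAt-root-if⁻ false θ H cl = cl

≥T-parent : ∀ {t} (θ : Threshold t) b p n → ((𝟙 (isRoot p ∧ b) + n) ≥T θ p) ≡ (n ≥T decAt-root-if b θ p)
≥T-parent θ true  root        n = ≥T-suc n (θ root)
≥T-parent θ false root        n = refl
≥T-parent θ true  (child _ _) n = refl
≥T-parent θ false (child _ _) n = refl

module NodeSets (k : ℕ) (f : Fin k → Tree) where

  infixl 9 _↓_

  _↓_ : VSet (node k f) → (i : Fin k) → VSet (f i)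
  H ↓ i = H ∘ child i

  graft : Bool → ((i : Fin k) → VSet (f i)) → VSet (node k f)
  graft b Y root        = b
  graft b Y (child i q) = Y i q

module AtNode {k : ℕ} {f : Fin k → Tree} (σ : Threshold (node k f)) where

  open NodeSets k f

  σ↓ : (i : Fin k) → Threshold (f i)
  σ↓ i = σ ∘ child i

  σ↓⁻ : (i : Fin k) → Threshold (f i)
  σ↓⁻ i = decAt root (σ↓ i)

  σ↓[_] : Bool → (i : Fin k) → Threshold (f i)
  σ↓[ b ] i = decAt-root-if b (σ↓ i)

  activeChildren : VSet (node k f) → ℕ
  activeChildren H = ∑[ i < k ] 𝟙 (H (child i root))

  RootClosed : VSet (node k f) → Set
  RootClosed H = (activeChildren H ≥T σ root) ≡ true → H root ≡ true

  ≥T-at-child : ∀ H i p →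
                (nbrCount H (child i p) ≥T σ (child i p)) ≡ (nbrCount (H ↓ i) p ≥T σ↓[ H root ] i p)
  ≥T-at-child H i p = trans (cong (_≥T σ (child i p)) (nbrCount-child H i p)) (≥T-parent (σ↓ i) (H root) p _)

  ≥T-at-root : ∀ H → (nbrCount H root ≥T σ root) ≡ (activeChildren H ≥T σ root)
  ≥T-at-root H = cong (_≥T σ root) (nbrCount-root H)

  Closed-node⁻ : ∀ H → Closed σ H → RootClosed H × (∀ i → Closed (σ↓[ H root ] i) (H ↓ i))
  Closed-node⁻ H cl = (λ n≥σ → cl root (trans (≥T-at-root H) n≥σ))
                    , (λ i p n≥σ → cl (child i p) (trans (≥T-at-child H i p) n≥σ))

  Closed-node⁺ : ∀ H → RootClosed H → (∀ i → Closed (σ↓[ H root ] i) (H ↓ i)) → Closed σ H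
  Closed-node⁺ H clr cl↓ root        n≥σ = clr (trans (sym (≥T-at-root H)) n≥σ)
  Closed-node⁺ H clr cl↓ (child i p) n≥σ = cl↓ i p (trans (sym (≥T-at-child H i p)) n≥σ)

  onlyAt : (i : Fin k) → VSet (f i) → (j : Fin k) → VSet (f j)
  onlyAt i H j with j ≟F i
  ... | yes refl = H
  ... | no _     = λ _ → true

  onlyAt-at : ∀ i H → onlyAt i H i ≡ H
  onlyAt-at i H with i ≟F i
  ... | yes refl = refl
  ... | no i≢i   = ⊥-elim (i≢i refl)

  DynMon↓ : ∀ D → DynMon σ D → ∀ i → DynMon (σ↓⁻ i) (D ↓ i)
  DynMon↓ D dm i H D↓i⊆H cl q = subst (λ H → H q ≡ true) (onlyAt-at i H) (dm G D⊆G G-closed (child i q))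
    where
    G : VSet (node k f)
    G = graft true (onlyAt i H)
    D⊆G : D ⊆ G
    D⊆G root        _   = refl
    D⊆G (child j p) Djp with j ≟F i
    ... | yes refl = D↓i⊆H p Djp
    ... | no _     = refl
    G-closed : Closed σ G
    G-closed = Closed-node⁺ G (λ _ → refl) closed↓
      where
      closed↓ : ∀ j → Closed (σ↓⁻ j) (onlyAt i H j)
      closed↓ j with j ≟F i
      ... | yes refl = cl
      ... | no _     = λ _ _ → refl

  dynMonChildren : VSet (node k f) → ℕ
  dynMonChildren D = ∑[ i < k ] 𝟙 (isDynMon (σ↓ i) (D ↓ i))

  DynMon-root∉⁻ : ∀ D → D root ≡ false → DynMon σ D → (dynMonChildren D ≥T σ root) ≡ true
  DynMon-root∉⁻ D Dr dm with dynMonChildren D ≥T σ root in enough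
  ... | true  = refl
  ... | false = ⊥-elim (false≢true (dm H D⊆H H-closed root))
    where
    hull↓ : ∀ i → ∃ λ H → D ↓ i ⊆ H × Closed (σ↓ i) H × H root ≡ isDynMon (σ↓ i) (D ↓ i)
    hull↓ i = closed-superset-with-root≡isDynMon (σ↓ i) (D ↓ i) (DynMon↓ D dm i)
    H : VSet (node k f)
    H = graft false (proj₁ ∘ hull↓)
    D⊆H : D ⊆ H
    D⊆H root        Dr≡true = trans (sym Dr) Dr≡true
    D⊆H (child i p) Dip     = proj₁ (proj₂ (hull↓ i)) p Dip
    H-closed : Closed σ H
    H-closed = Closed-node⁺ H root-closed (proj₁ ∘ proj₂ ∘ proj₂ ∘ hull↓)
      where
      root-closed : RootClosed H
      root-closed H≥σ = trans (sym enough) (trans (cong (_≥T σ root) (sym active≡dynMon)) H≥σ)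
        where
        active≡dynMon : activeChildren H ≡ dynMonChildren D
        active≡dynMon = sum-cong-≗ λ i → cong 𝟙 (proj₂ (proj₂ (proj₂ (hull↓ i))))

  Closed↓ : ∀ H → Closed σ H → ∀ i → Closed (σ↓ i) (H ↓ i)
  Closed↓ H cl i = Closed-decAt-root-if⁻ (H root) (σ↓ i) (H ↓ i) (proj₂ (Closed-node⁻ H cl) i)

  full-if-root∈ : ∀ D H → (∀ i → DynMon (σ↓⁻ i) (D ↓ i)) → D ⊆ H → Closed σ H → H root ≡ true → Full H
  full-if-root∈ D H dm↓ D⊆H cl Hr root        = Hr
  full-if-root∈ D H dm↓ D⊆H cl Hr (child i p) =
    dm↓ i (H ↓ i) (λ q → D⊆H (child i q))
        (subst (λ b → Closed (σ↓[ b ] i) (H ↓ i)) Hr (proj₂ (Closed-node⁻ H cl) i)) p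

  DynMon-root∈⁺ : ∀ D → D root ≡ true → (∀ i → DynMon (σ↓⁻ i) (D ↓ i)) → DynMon σ D
  DynMon-root∈⁺ D Dr dm↓ H D⊆H cl = full-if-root∈ D H dm↓ D⊆H cl (D⊆H root Dr)

  DynMon-root∉⁺ : ∀ D → (∀ i → DynMon (σ↓⁻ i) (D ↓ i)) → (dynMonChildren D ≥T σ root) ≡ true →
                  DynMon σ D
  DynMon-root∉⁺ D dm↓ enough H D⊆H cl = full-if-root∈ D H dm↓ D⊆H cl root∈H
    where
    root∈H : H root ≡ true
    root∈H = proj₁ (Closed-node⁻ H cl) (≥T-mono (σ root) (count-mono dynMon⇒active) enough)
      where
      dynMon⇒active : ∀ i → isDynMon (σ↓ i) (D ↓ i) ≡ true → H (child i root) ≡ true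
      dynMon⇒active i mon =
        isDynMon-true⁻ (σ↓ i) (D ↓ i) mon (H ↓ i) (λ q → D⊆H (child i q)) (Closed↓ H cl i) root

  dyn↓ : Fin k → ℕ
  dyn↓ i = dyn (f i) (σ↓ i)

  dyn↓⁻ : Fin k → ℕ
  dyn↓⁻ i = dyn (f i) (σ↓⁻ i)

  childrenCost : ℕ
  childrenCost = ∑[ i < k ] dyn↓⁻ i

  selfSufficient : Fin k → Bool
  selfSufficient i = does (dyn↓ i ≟ dyn↓⁻ i)

  #selfSufficient : ℕ
  #selfSufficient = ∑[ i < k ] 𝟙 (selfSufficient i)

  rootNeeded : Bool
  rootNeeded = not (#selfSufficient ≥T σ root)

  card-split : ∀ D {b} → D root ≡ b → card D ≡ 𝟙 b + ∑[ i < k ] card (D ↓ i)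
  card-split D Dr = trans (card-node D) (cong (λ b → 𝟙 b + ∑[ i < k ] card (D ↓ i)) Dr)

  dyn↓⁻≤card : ∀ D → DynMon σ D → ∀ i → dyn↓⁻ i ≤ card (D ↓ i)
  dyn↓⁻≤card D dm i = dyn-minimal (σ↓⁻ i) (D ↓ i) (DynMon↓ D dm i)

  dyn-node-lower-root∈ : ∀ D → DynMon σ D → D root ≡ true → childrenCost + 𝟙 rootNeeded ≤ card D
  dyn-node-lower-root∈ D dm Dr = begin
    childrenCost + 𝟙 rootNeeded          ≤⟨ +-monoʳ-≤ childrenCost (𝟙≤1 rootNeeded) ⟩
    childrenCost + 1                     ≡⟨ +-comm childrenCost 1 ⟩
    suc childrenCost                     ≤⟨ s≤s (sum-mono-≤ (dyn↓⁻≤card D dm)) ⟩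
    𝟙 true + ∑[ i < k ] card (D ↓ i)     ≡⟨ card-split D Dr ⟨
    card D                               ∎
    where open ≤-Reasoning

  dyn-node-lower-root∉ : ∀ D → DynMon σ D → D root ≡ false → childrenCost + 𝟙 rootNeeded ≤ card D
  dyn-node-lower-root∉ D dm Dr with #selfSufficient ≥T σ root in enough
  ... | true = begin
    childrenCost + 0                     ≡⟨ +-identityʳ childrenCost ⟩
    childrenCost                         ≤⟨ sum-mono-≤ (dyn↓⁻≤card D dm) ⟩
    𝟙 false + ∑[ i < k ] card (D ↓ i)    ≡⟨ card-split D Dr ⟨
    card D                               ∎
    where open ≤-Reasoning
  ... | false with ⇒ᵇ-all-or-counterexample (λ i → isDynMon (σ↓ i) (D ↓ i)) selfSufficient
  ...   | inj₁ mon⇒ss =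
    ⊥-elim (false≢true (trans (sym enough) (≥T-mono (σ root) (count-mono mon⇒ss) (DynMon-root∉⁻ D Dr dm))))
  ...   | inj₂ (i , mon , not-ss) = begin
    childrenCost + 1                     ≡⟨ +-comm childrenCost 1 ⟩
    suc childrenCost                     ≤⟨ sum-mono-< (dyn↓⁻≤card D dm) i helped ⟩
    𝟙 false + ∑[ i < k ] card (D ↓ i)    ≡⟨ card-split D Dr ⟨
    card D                               ∎
    where
    open ≤-Reasoning
    dyn↓⁻<dyn↓ : dyn↓⁻ i < dyn↓ i
    dyn↓⁻<dyn↓ = ≤∧≢⇒< (dyn-decAt-root-≤ (σ↓ i))
                       λ eq → false≢true (trans (sym not-ss) (dec-true (dyn↓ i ≟ dyn↓⁻ i) (sym eq)))
    helped : dyn↓⁻ i < card (D ↓ i)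
    helped = <-≤-trans dyn↓⁻<dyn↓ (dyn-minimal (σ↓ i) (D ↓ i) (isDynMon-true⁻ (σ↓ i) (D ↓ i) mon))

  dyn-node-lower : ∀ D → DynMon σ D → childrenCost + 𝟙 rootNeeded ≤ card D
  dyn-node-lower D dm = by-root (D root) refl
    where
    by-root : ∀ b → D root ≡ b → childrenCost + 𝟙 rootNeeded ≤ card D
    by-root true  = dyn-node-lower-root∈ D dm
    by-root false = dyn-node-lower-root∉ D dm

  optimal↓ : (i : Fin k) → VSet (f i)
  optimal↓ i = if selfSufficient i then proj₁ (dyn-attained (σ↓ i)) else proj₁ (dyn-attained (σ↓⁻ i))

  optimal↓-spec : ∀ i → DynMon (σ↓⁻ i) (optimal↓ i) × card (optimal↓ i) ≡ dyn↓⁻ i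
                        × (selfSufficient i ≡ true → isDynMon (σ↓ i) (optimal↓ i) ≡ true)
  optimal↓-spec i with selfSufficient i in ss | dyn-attained (σ↓ i) | dyn-attained (σ↓⁻ i)
  ... | true  | D , dm , cardD | _ = DynMon-decAt-root (σ↓ i) D dm , trans cardD (does-≟⁻ ss)
                                   , λ _ → isDynMon-true⁺ (σ↓ i) D dm
  ... | false | _ | D , dm , cardD = dm , cardD , λ ()

  dyn-node-upper : ∃ λ D → DynMon σ D × card D ≡ childrenCost + 𝟙 rootNeeded
  dyn-node-upper with #selfSufficient ≥T σ root in enough
  ... | true  = graft false optimal↓
              , DynMon-root∉⁺ (graft false optimal↓) (λ i → proj₁ (optimal↓-spec i))
                  (≥T-mono (σ root) (count-mono λ i → proj₂ (proj₂ (optimal↓-spec i))) enough)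
              , trans (card-node (graft false optimal↓))
                      (trans (sum-cong-≗ λ i → proj₁ (proj₂ (optimal↓-spec i))) (sym (+-identityʳ childrenCost)))
  ... | false = graft true (proj₁ ∘ optimal↓⁻)
              , DynMon-root∈⁺ (graft true (proj₁ ∘ optimal↓⁻)) refl
                               (λ i → proj₁ (proj₂ (optimal↓⁻ i)))
              , trans (card-node (graft true (proj₁ ∘ optimal↓⁻)))
                      (trans (cong suc (sum-cong-≗ λ i → proj₂ (proj₂ (optimal↓⁻ i)))) (+-comm 1 childrenCost))
    where
    optimal↓⁻ : ∀ i → ∃ λ D → DynMon (σ↓⁻ i) D × card D ≡ dyn↓⁻ i
    optimal↓⁻ i = dyn-attained (σ↓⁻ i)

  dyn-node : dyn (node k f) σ ≡ childrenCost + 𝟙 rootNeeded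
  dyn-node with dyn-node-upper | dyn-attained σ
  ... | D , dm , cardD | D′ , dm′ , cardD′ =
    ≤-antisym (subst (dyn (node k f) σ ≤_) cardD (dyn-minimal σ D dm))
              (subst (childrenCost + 𝟙 rootNeeded ≤_) cardD′ (dyn-node-lower D′ dm′))

infix 4 _≤E_

data _≤E_ : ℕ⁻∞ → ℕ⁻∞ → Set where
  -∞≤      : ∀ {y} → -∞ ≤E y
  val≤val  : ∀ {m n} → m ≤ n → val m ≤E val n

≤E-refl : ∀ {x} → x ≤E x
≤E-refl { -∞}   = -∞≤
≤E-refl {val m} = val≤val ≤-refl

≤E-trans : ∀ {x y z} → x ≤E y → y ≤E z → x ≤E z
≤E-trans -∞≤          _             = -∞≤
≤E-trans (val≤val m≤n) (val≤val n≤o) = val≤val (≤-trans m≤n n≤o)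

≤E-antisym : ∀ {x y} → x ≤E y → y ≤E x → x ≡ y
≤E-antisym -∞≤           -∞≤           = refl
≤E-antisym (val≤val m≤n) (val≤val n≤m) = cong val (≤-antisym m≤n n≤m)

val≤E⁻ : ∀ {m y} → val m ≤E y → ∃ λ n → y ≡ val n × m ≤ n
val≤E⁻ (val≤val m≤n) = _ , refl , m≤n

≤E-∞⁻ : ∀ {x} → x ≤E -∞ → x ≡ -∞
≤E-∞⁻ -∞≤ = refl

⊔E-upperˡ : ∀ x y → x ≤E x ⊔E y
⊔E-upperˡ -∞      y       = -∞≤
⊔E-upperˡ (val m) -∞      = ≤E-refl
⊔E-upperˡ (val m) (val n) = val≤val (m≤m⊔n m n)

⊔E-upperʳ : ∀ x y → y ≤E x ⊔E y
⊔E-upperʳ -∞      y       = ≤E-refl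
⊔E-upperʳ (val m) -∞      = -∞≤
⊔E-upperʳ (val m) (val n) = val≤val (m≤n⊔m m n)

⊔E-least : ∀ {x y z} → x ≤E z → y ≤E z → x ⊔E y ≤E z
⊔E-least -∞≤           y≤z           = y≤z
⊔E-least (val≤val m≤o) -∞≤           = val≤val m≤o
⊔E-least (val≤val m≤o) (val≤val n≤o) = val≤val (⊔-lub m≤o n≤o)

⊔E-sel : ∀ x y → x ⊔E y ≡ x ⊎ x ⊔E y ≡ y
⊔E-sel -∞      y       = inj₂ refl
⊔E-sel (val m) -∞      = inj₁ refl
⊔E-sel (val m) (val n) with ⊔-sel m n
... | inj₁ m⊔n≡m = inj₁ (cong val m⊔n≡m)
... | inj₂ m⊔n≡n = inj₂ (cong val m⊔n≡n)

⊔E-absorbˡ : ∀ {x y} → y ≤E x → x ⊔E y ≡ x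
⊔E-absorbˡ { -∞}   -∞≤           = refl
⊔E-absorbˡ {val m} -∞≤           = refl
⊔E-absorbˡ         (val≤val n≤m) = cong val (m≥n⇒m⊔n≡m n≤m)

⊔E-absorbʳ : ∀ {x y} → x ≤E y → x ⊔E y ≡ y
⊔E-absorbʳ -∞≤           = refl
⊔E-absorbʳ (val≤val m≤n) = cong val (m≤n⇒m⊔n≡n m≤n)

infix 4 _<E_

data _<E_ : ℕ⁻∞ → ℕ⁻∞ → Set where
  -∞<val   : ∀ {n} → -∞ <E val n
  val<val  : ∀ {m n} → m < n → val m <E val n

≤E-or->E : ∀ x y → y ≤E x ⊎ x <E y
≤E-or->E x       -∞      = inj₁ -∞≤
≤E-or->E -∞      (val n) = inj₂ -∞<val
≤E-or->E (val m) (val n) with n ≤? m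
... | yes n≤m = inj₁ (val≤val n≤m)
... | no  n≰m = inj₂ (val<val (≰⇒> n≰m))

<E-val⁻ : ∀ {x y} → x <E y → ∃ λ n → y ≡ val n
<E-val⁻ -∞<val      = _ , refl
<E-val⁻ (val<val _) = _ , refl

<E⇒≤E : ∀ {x y} → x <E y → x ≤E y
<E⇒≤E -∞<val        = -∞≤
<E⇒≤E (val<val m<n) = val≤val (<⇒≤ m<n)

<E-val-pred : ∀ {x m n} → x <E val m → m ≤ suc n → x ≤E val n
<E-val-pred -∞<val        _       = -∞≤
<E-val-pred (val<val l<m) m≤1+n = val≤val (≤-pred (≤-trans l<m m≤1+n))

maxE-upper : ∀ xs {x} → x ∈ xs → x ≤E maxE xs
maxE-upper (y ∷ xs) (here refl) = ⊔E-upperˡ y (maxE xs)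
maxE-upper (y ∷ xs) (there x∈)  = ≤E-trans (maxE-upper xs x∈) (⊔E-upperʳ y (maxE xs))

maxE-least : ∀ xs {z} → (∀ {x} → x ∈ xs → x ≤E z) → maxE xs ≤E z
maxE-least []       _     = -∞≤
maxE-least (y ∷ xs) bound = ⊔E-least (bound (here refl)) (maxE-least xs (bound ∘ there))

maxE-attained : ∀ xs → maxE xs ≡ -∞ ⊎ maxE xs ∈ xs
maxE-attained []       = inj₁ refl
maxE-attained (y ∷ xs) with ⊔E-sel y (maxE xs) | maxE-attained xs
... | inj₁ max≡y | _          = inj₂ (here max≡y)
... | inj₂ max≡m | inj₁ m≡-∞  = inj₁ (trans max≡m m≡-∞)
... | inj₂ max≡m | inj₂ m∈xs  = inj₂ (there (subst (_∈ xs) (sym max≡m) m∈xs))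

maxE-map-attained : ∀ (g : A → ℕ⁻∞) xs {n} → maxE (map g xs) ≡ val n → ∃ λ x → x ∈ xs × g x ≡ val n
maxE-map-attained g xs max≡n with maxE-attained (map g xs)
... | inj₁ max≡-∞ with () ← trans (sym max≡n) max≡-∞
... | inj₂ max∈ with ∈-map⁻ g max∈
... | x , x∈ , max≡gx = x , x∈ , trans (sym max≡gx) max≡n

val-injective : ∀ {m n} → val m ≡ val n → m ≡ n
val-injective refl = refl

==E-val : ∀ {x n} → (x ==E val n) ≡ true → x ≡ val n
==E-val {val m} m≟n = cong val (does-≟⁻ m≟n)

+E-∞ʳ : ∀ x → x +E -∞ ≡ -∞
+E-∞ʳ -∞      = refl
+E-∞ʳ (val m) = refl

+E-monoˡ-≤ : ∀ {m n} → m ≤ n → ∀ x → val m +E x ≤E val n +E x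
+E-monoˡ-≤ m≤n -∞      = -∞≤
+E-monoˡ-≤ m≤n (val o) = val≤val (+-monoˡ-≤ o m≤n)

sumE-val : ∀ k (a : Vector ℕ k) → sumE k (val ∘ a) ≡ val (sum a)
sumE-val zero    a = refl
sumE-val (suc k) a = cong (val (a zero) +E_) (sumE-val k (a ∘ suc))

sumE-cong : ∀ k {a b : Fin k → ℕ⁻∞} → a ≗ b → sumE k a ≡ sumE k b
sumE-cong zero    a≗b = refl
sumE-cong (suc k) a≗b = cong₂ _+E_ (a≗b zero) (sumE-cong k (a≗b ∘ suc))

sumE-∞ : ∀ k (a : Fin k → ℕ⁻∞) i → a i ≡ -∞ → sumE k a ≡ -∞
sumE-∞ (suc k) a zero    ai≡-∞ = cong (_+E sumE k (a ∘ suc)) ai≡-∞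
sumE-∞ (suc k) a (suc i) ai≡-∞ = trans (cong (a zero +E_) (sumE-∞ k (a ∘ suc) i ai≡-∞)) (+E-∞ʳ (a zero))

module _ {t : Tree} (θ : Threshold t) (b : ℕ) where

  vacc₁-upper : ∀ X → card X ≡ b → val (dyn t (θ [ X ]∞)) ≤E vacc₁ t θ b
  vacc₁-upper X cardX with allSets-complete t X
  ... | X′ , X′∈ , X′≗X =
    subst (λ n → val n ≤E vacc₁ t θ b) (dyn-cong λ v → cong (λ x → if x then ∞ else θ v) (X′≗X v))
      (maxE-upper _ (∈-map⁺ _ (∈-filter⁺ _ X′∈ (≡⇒T cardX′≡b))))
    where
    cardX′≡b : does (card X′ ≟ b) ≡ true
    cardX′≡b = dec-true (card X′ ≟ b) (trans (card-cong X′≗X) cardX)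

  vacc₁-least : ∀ {y} → (∀ X → card X ≡ b → val (dyn t (θ [ X ]∞)) ≤E y) → vacc₁ t θ b ≤E y
  vacc₁-least bound = maxE-least _ λ x∈ →
    let X , X∈ , x≡ = ∈-map⁻ _ x∈
    in subst (_≤E _) (sym x≡) (bound X (does-≟⁻ (T⇒≡ (proj₂ (∈-filter⁻ _ {xs = allSets t} X∈)))))

  vacc₁-too-large : size t < b → vacc₁ t θ b ≡ -∞
  vacc₁-too-large size<b =
    ≤E-∞⁻ (vacc₁-least λ X cardX → ⊥-elim (<⇒≱ size<b (subst (_≤ size t) cardX (card≤size X))))

vacc₁-cong : ∀ {t} {θ θ′ : Threshold t} b → θ ≗ θ′ → vacc₁ t θ b ≡ vacc₁ t θ′ b
vacc₁-cong {t} {θ} {θ′} b θ≗θ′ = ≤E-antisym (vacc₁-least θ b (bound θ≗θ′)) (vacc₁-least θ′ b (bound (sym ∘ θ≗θ′)))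
  where
  bound : ∀ {θ₁ θ₂} → θ₁ ≗ θ₂ → ∀ X → card X ≡ b → val (dyn t (θ₁ [ X ]∞)) ≤E vacc₁ t θ₂ b
  bound {θ₁} {θ₂} θ₁≗θ₂ X cardX =
    subst (λ n → val n ≤E vacc₁ t θ₂ b) (dyn-cong λ v → cong (λ θv → if X v then ∞ else θv) (sym (θ₁≗θ₂ v)))
          (vacc₁-upper θ₂ b X cardX)

comps-sound : ∀ k b {bs} → bs ∈ comps k b → sum bs ≡ b
comps-sound zero    zero (here refl) = refl
comps-sound (suc k) b    bs∈ with find (∈-concatMap⁻ _ {xs = upTo (suc b)} bs∈)
... | b₀ , b₀∈ , bs∈′ with ∈-map⁻ _ bs∈′
... | g , g∈ , refl =
  trans (cong (b₀ +_) (comps-sound k (b ∸ b₀) g∈)) (m+[n∸m]≡n (≤-pred (∈-upTo⁻ b₀∈)))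

comps-complete : ∀ k b (bs : Vector ℕ k) → sum bs ≡ b → ∃ λ bs′ → bs′ ∈ comps k b × bs′ ≗ bs
comps-complete zero    zero bs _    = _ , here refl , λ ()
comps-complete (suc k) b  bs sum≡b
  with comps-complete k (b ∸ bs zero) (bs ∘ suc) (trans (sym (m+n∸m≡n (bs zero) _)) (cong (_∸ bs zero) sum≡b))
... | g , g∈ , g≗ = _ , ∈-concatMap⁺ _ (Any.map (λ { refl → ∈-map⁺ _ g∈ }) (∈-upTo⁺ (s≤s bs₀≤b)))
                      , λ { zero → refl ; (suc i) → g≗ i }
  where
  bs₀≤b : bs zero ≤ b
  bs₀≤b = subst (bs zero ≤_) sum≡b (m≤m+n (bs zero) _)

composition-below : ∀ k (s : Vector ℕ k) b → b ≤ sum s → ∃ λ bs → (∀ i → bs i ≤ s i) × sum bs ≡ b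
composition-below zero    s zero b≤ = (λ ()) , (λ ()) , refl
composition-below (suc k) s b    b≤ with ≤-total b (s zero)
... | inj₁ b≤s₀ =
  let bs , bs≤ , sum≡ = composition-below k (s ∘ suc) 0 z≤n
  in (λ { zero → b ; (suc i) → bs i }) , (λ { zero → b≤s₀ ; (suc i) → bs≤ i })
   , trans (cong (b +_) sum≡) (+-identityʳ b)
... | inj₂ s₀≤b =
  let bs , bs≤ , sum≡ = composition-below k (s ∘ suc) (b ∸ s zero) (m≤n+o⇒m∸n≤o b (s zero) b≤)
  in (λ { zero → s zero ; (suc i) → bs i }) , (λ { zero → ≤-refl ; (suc i) → bs≤ i })
   , trans (cong (s zero +_) sum≡) (m+[n∸m]≡n s₀≤b)

-- The recurrence at the root

≟P-child : ∀ {k f} (j : Fin k) (p q : Pos (f j)) → (_≟P_ {node k f} (child j p) (child j q)) ≡ (p ≟P q)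
≟P-child j p q with j ≟F j
... | yes refl = refl
... | no j≢j   = ⊥-elim (j≢j refl)

decAt-child : ∀ {k f} (τ : Threshold (node k f)) j (p : Pos (f j)) →
              (λ q → decAt (child j p) τ (child j q)) ≗ decAt p (τ ∘ child j)
decAt-child τ j p q = cong (λ c → if c then dec (τ (child j q)) else τ (child j q)) (≟P-child j p q)

decAt-[]∞ : ∀ {t} (u : Pos t) (τ : Threshold t) X → decAt u (τ [ X ]∞) ≗ (decAt u τ) [ X ]∞
decAt-[]∞ u τ X v with u ≟P v | X v
... | true  | true  = refl
... | true  | false = refl
... | false | _     = refl

Realizes : (T : Tree) → Threshold T → (u : Pos T) → ℕ → VSet (sub T u) → Set
Realizes T τ u b X = card X ≡ b
                   × val (dyn (sub T u) ((restrict u τ) [ X ]∞)) ≡ x₀ T τ u b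
                   × val (dyn (sub T u) ((restrict u (decAt u τ)) [ X ]∞)) ≡ x₁ T τ u b

Realizable : (T : Tree) → Threshold T → Pos T → ℕ → Set
Realizable T τ u b = Σ (VSet (sub T u)) (Realizes T τ u b)

ChildrenRealizable : (T : Tree) → Threshold T → Pos T → Set
ChildrenRealizable T τ u =
  (i : Fin (nch (sub T u))) (bᵢ : ℕ) → bᵢ ≤ size (sub T (kids T u i)) → Realizable T τ (kids T u i) bᵢ

Recurrence : (T : Tree) → Threshold T → Pos T → ℕ → Set
Recurrence T τ u b = (j : Fin 2) → xj j T τ u b ≡ (zU T τ u b ⊔E zJ j T τ u b)

module AtRoot {k : ℕ} {f : Fin k → Tree} (τ : Threshold (node k f)) where

  open NodeSets k f

  Z : ℕ → ℕ⁻∞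
  Z = zU (node k f) τ root

  Z[_] : Fin 2 → ℕ → ℕ⁻∞
  Z[ j ] = zJ j (node k f) τ root

  τ↓ : (i : Fin k) → Threshold (f i)
  τ↓ i = τ ∘ child i

  τ↓⁻ : (i : Fin k) → Threshold (f i)
  τ↓⁻ i = restrict (child i root) (decAt (child i root) τ)

  x₀↓ x₁↓ : Fin k → ℕ → ℕ⁻∞
  x₀↓ i = x₀ (node k f) τ (child i root)
  x₁↓ i = x₁ (node k f) τ (child i root)

  τ^ : Fin 2 → Threshold (node k f)
  τ^ zero    = τ
  τ^ (suc _) = decAt root τ

  xj≡vacc₁ : ∀ j b → xj j (node k f) τ root b ≡ vacc₁ (node k f) (τ^ j) b
  xj≡vacc₁ zero          b = refl
  xj≡vacc₁ (suc zero)    b = refl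

  τ^-root : ∀ j → τ^ j root ≡ decJ j (τ root)
  τ^-root zero       = refl
  τ^-root (suc zero) = refl

  d e : VSet (node k f) → Fin k → ℕ
  d X i = dyn (f i) ((τ↓ i) [ X ↓ i ]∞)
  e X i = dyn (f i) ((τ↓⁻ i) [ X ↓ i ]∞)

  agree : VSet (node k f) → Fin k → Bool
  agree X i = does (d X i ≟ e X i)

  #agree : VSet (node k f) → ℕ
  #agree X = ∑[ i < k ] 𝟙 (agree X i)

  decAt-root-τ↓ : ∀ i Y → decAt root ((τ↓ i) [ Y ]∞) ≗ (τ↓⁻ i) [ Y ]∞
  decAt-root-τ↓ i Y q = trans (decAt-[]∞ root (τ↓ i) Y q)
                              (cong (λ θ → if Y q then ∞ else θ) (sym (decAt-child τ i root q)))

  e≤d : ∀ X i → e X i ≤ d X i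
  e≤d X i = subst (_≤ d X i) (dyn-cong (decAt-root-τ↓ i (X ↓ i))) (dyn-decAt-root-≤ ((τ↓ i) [ X ↓ i ]∞))

  dyn-off-root : ∀ (σ : Threshold (node k f)) → (∀ i → σ ∘ child i ≗ τ↓ i) → ∀ X →
                 dyn (node k f) (σ [ X ]∞) ≡ ∑[ i < k ] e X i + 𝟙 (not (#agree X ≥T (σ [ X ]∞) root))
  dyn-off-root σ σ≗τ X =
    trans (AtNode.dyn-node (σ [ X ]∞))
          (cong₂ (λ c n → c + 𝟙 (not (n ≥T (σ [ X ]∞) root)))
                 (sum-cong-≗ dyn↓⁻≡e)
                 (sum-cong-≗ λ i → cong 𝟙 (cong₂ (λ m n → does (m ≟ n)) (dyn↓≡d i) (dyn↓⁻≡e i))))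
    where
    σX↓≗ : ∀ i → (σ [ X ]∞) ∘ child i ≗ (τ↓ i) [ X ↓ i ]∞
    σX↓≗ i q = cong (λ θ → if X (child i q) then ∞ else θ) (σ≗τ i q)
    dyn↓≡d : ∀ i → AtNode.dyn↓ (σ [ X ]∞) i ≡ d X i
    dyn↓≡d i = dyn-cong (σX↓≗ i)
    dyn↓⁻≡e : ∀ i → AtNode.dyn↓⁻ (σ [ X ]∞) i ≡ e X i
    dyn↓⁻≡e i = dyn-cong λ q → trans (cong (λ θ → if root ≟P q then dec θ else θ) (σX↓≗ i q))
                                     (decAt-root-τ↓ i (X ↓ i) q)

  τ^-off-root : ∀ j i → τ^ j ∘ child i ≗ τ↓ i
  τ^-off-root zero       i q = refl
  τ^-off-root (suc zero) i q = refl

  dyn-root∈ : ∀ j X → X root ≡ true → dyn (node k f) ((τ^ j) [ X ]∞) ≡ ∑[ i < k ] e X i + 1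
  dyn-root∈ j X Xr = trans (dyn-off-root (τ^ j) (τ^-off-root j) X)
                           (cong (λ x → ∑[ i < k ] e X i + 𝟙 (not (#agree X ≥T (if x then ∞ else τ^ j root)))) Xr)

  dyn-root∉ : ∀ j X → X root ≡ false →
              dyn (node k f) ((τ^ j) [ X ]∞) ≡ ∑[ i < k ] e X i + 𝟙 (not (#agree X ≥T decJ j (τ root)))
  dyn-root∉ j X Xr = trans (dyn-off-root (τ^ j) (τ^-off-root j) X)
                           (cong (λ θ → ∑[ i < k ] e X i + 𝟙 (not (#agree X ≥T θ)))
                                 (trans (cong (λ x → if x then ∞ else τ^ j root) Xr) (τ^-root j)))

  zU-term : Vector ℕ k → ℕ⁻∞
  zU-term bs = val 1 +E sumE k (λ i → x₁↓ i (bs i))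

  zJ-term : Fin 2 → Vector ℕ k → ℕ⁻∞
  zJ-term j bs = val (δ j (node k f) τ root bs) +E sumE k (λ i → x₁↓ i (bs i))

  #x-agree : Vector ℕ k → ℕ
  #x-agree bs = countFin k (λ i → x₀↓ i (bs i) ==E x₁↓ i (bs i))

  δ≡𝟙 : ∀ j bs → δ j (node k f) τ root bs ≡ 𝟙 (not (#x-agree bs ≥T decJ j (τ root)))
  δ≡𝟙 j bs = if-then-0-else-1 (#x-agree bs ≥T decJ j (τ root))

  x-sum-cong : ∀ {bs bs′} → bs ≗ bs′ → sumE k (λ i → x₁↓ i (bs i)) ≡ sumE k (λ i → x₁↓ i (bs′ i))
  x-sum-cong bs≗ = sumE-cong k λ i → cong (x₁↓ i) (bs≗ i)

  zU-term-cong : ∀ {bs bs′} → bs ≗ bs′ → zU-term bs ≡ zU-term bs′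
  zU-term-cong bs≗ = cong (val 1 +E_) (x-sum-cong bs≗)

  zJ-term-cong : ∀ j {bs bs′} → bs ≗ bs′ → zJ-term j bs ≡ zJ-term j bs′
  zJ-term-cong j bs≗ =
    cong₂ _+E_ (cong (λ n → val (if n ≥T decJ j (τ root) then 0 else 1))
                     (length-filterᵇ-cong (λ i → cong (λ b → x₀↓ i b ==E x₁↓ i b) (bs≗ i)) (allFin k)))
               (x-sum-cong bs≗)

  zU-upper : ∀ b bs → sum bs ≡ b → zU-term bs ≤E Z (suc b)
  zU-upper b bs sum≡b with comps-complete k b bs sum≡b
  ... | bs′ , bs′∈ , bs′≗ = subst (_≤E _) (zU-term-cong bs′≗) (maxE-upper _ (∈-map⁺ zU-term bs′∈))

  zJ-upper : ∀ j b bs → sum bs ≡ b → zJ-term j bs ≤E Z[ j ] b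
  zJ-upper j b bs sum≡b with comps-complete k b bs sum≡b
  ... | bs′ , bs′∈ , bs′≗ = subst (_≤E _) (zJ-term-cong j bs′≗) (maxE-upper _ (∈-map⁺ (zJ-term j) bs′∈))

  module Split (X : VSet (node k f)) where

    part : Vector ℕ k
    part i = card (X ↓ i)

    x₁↓-finite : ∀ i → ∃ λ w → x₁↓ i (part i) ≡ val w × e X i ≤ w
    x₁↓-finite i = val≤E⁻ (vacc₁-upper (τ↓⁻ i) (part i) (X ↓ i) refl)

    w : Vector ℕ k
    w i = proj₁ (x₁↓-finite i)

    e≤w : ∀ i → e X i ≤ w i
    e≤w i = proj₂ (proj₂ (x₁↓-finite i))

    x-sum≡ : sumE k (λ i → x₁↓ i (part i)) ≡ val (sum w)
    x-sum≡ = trans (sumE-cong k λ i → proj₁ (proj₂ (x₁↓-finite i))) (sumE-val k w)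

    x-agree⇒agree : e X ≗ w → ∀ i → (x₀↓ i (part i) ==E x₁↓ i (part i)) ≡ true → agree X i ≡ true
    x-agree⇒agree e≗w i x-agree = dec-true (d X i ≟ e X i) (≤-antisym d≤e (e≤d X i))
      where
      x₀≡w : x₀↓ i (part i) ≡ val (w i)
      x₀≡w = ==E-val (subst (λ y → (x₀↓ i (part i) ==E y) ≡ true) (proj₁ (proj₂ (x₁↓-finite i))) x-agree)
      d≤e : d X i ≤ e X i
      d≤e with val≤E⁻ (subst (val (d X i) ≤E_) x₀≡w (vacc₁-upper (τ↓ i) (part i) (X ↓ i) refl))
      ... | _ , refl , d≤w = subst (d X i ≤_) (sym (e≗w i)) d≤w

  dyn-upper-root∈ : ∀ j X → X root ≡ true → val (dyn (node k f) ((τ^ j) [ X ]∞)) ≤E zU-term (Split.part X)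
  dyn-upper-root∈ j X Xr =
    subst₂ _≤E_ (cong val (sym (dyn-root∈ j X Xr))) (cong (val 1 +E_) (sym x-sum≡))
      (val≤val (begin
        ∑[ i < k ] e X i + 1   ≡⟨ +-comm _ 1 ⟩
        suc (∑[ i < k ] e X i) ≤⟨ s≤s (sum-mono-≤ e≤w) ⟩
        suc (sum w)            ∎))
    where
    open Split X
    open ≤-Reasoning

  dyn-upper-root∉ : ∀ j X → X root ≡ false → val (dyn (node k f) ((τ^ j) [ X ]∞)) ≤E zJ-term j (Split.part X)
  dyn-upper-root∉ j X Xr =
    subst₂ _≤E_ (cong val (sym (dyn-root∉ j X Xr))) (sym (cong₂ _+E_ (cong val (δ≡𝟙 j part)) x-sum≡))
      (val≤val (bound (sum-<-or-≗ e≤w)))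
    where
    open Split X
    open ≤-Reasoning
    θ = decJ j (τ root)
    bound : ∑[ i < k ] e X i < sum w ⊎ e X ≗ w →
            ∑[ i < k ] e X i + 𝟙 (not (#agree X ≥T θ)) ≤ 𝟙 (not (#x-agree part ≥T θ)) + sum w
    bound (inj₁ ∑e<∑w) = begin
      ∑[ i < k ] e X i + 𝟙 (not (#agree X ≥T θ)) ≤⟨ +-monoʳ-≤ (∑[ i < k ] e X i) (𝟙≤1 _) ⟩
      ∑[ i < k ] e X i + 1                        ≡⟨ +-comm _ 1 ⟩
      suc (∑[ i < k ] e X i)                      ≤⟨ ∑e<∑w ⟩
      sum w                                       ≤⟨ m≤n+m (sum w) _ ⟩
      𝟙 (not (#x-agree part ≥T θ)) + sum w        ∎
    bound (inj₂ e≗w) = begin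
      ∑[ i < k ] e X i + 𝟙 (not (#agree X ≥T θ)) ≡⟨ cong (_+ 𝟙 (not (#agree X ≥T θ))) (sum-cong-≗ e≗w) ⟩
      sum w + 𝟙 (not (#agree X ≥T θ))            ≤⟨ +-monoʳ-≤ (sum w) (𝟙-not-anti x-agree⇒agree′) ⟩
      sum w + 𝟙 (not (#x-agree part ≥T θ))       ≡⟨ +-comm (sum w) _ ⟩
      𝟙 (not (#x-agree part ≥T θ)) + sum w        ∎
      where
      x-agree⇒agree′ : (#x-agree part ≥T θ) ≡ true → (#agree X ≥T θ) ≡ true
      x-agree⇒agree′ = ≥T-mono θ (subst (_≤ #agree X) (sym (countFin≡sum k _)) (count-mono (x-agree⇒agree e≗w)))

  dyn≤zU⊔zJ : ∀ j b X → card X ≡ b → val (dyn (node k f) ((τ^ j) [ X ]∞)) ≤E Z b ⊔E Z[ j ] b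
  dyn≤zU⊔zJ j b X cardX = by-root (X root) refl
    where
    card≡ : ∀ {r} → X root ≡ r → 𝟙 r + sum (Split.part X) ≡ b
    card≡ Xr = trans (cong (λ r → 𝟙 r + sum (Split.part X)) (sym Xr)) (trans (sym (card-node X)) cardX)
    by-root : ∀ r → X root ≡ r → val (dyn (node k f) ((τ^ j) [ X ]∞)) ≤E Z b ⊔E Z[ j ] b
    by-root true  Xr = ≤E-trans (dyn-upper-root∈ j X Xr)
                         (≤E-trans (subst (λ b → zU-term _ ≤E Z b) (card≡ Xr) (zU-upper _ _ refl))
                                   (⊔E-upperˡ _ _))
    by-root false Xr = ≤E-trans (dyn-upper-root∉ j X Xr) (≤E-trans (zJ-upper j b _ (card≡ Xr)) (⊔E-upperʳ _ _))

  Fits : Vector ℕ k → Set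
  Fits bs = ∀ i → bs i ≤ size (f i)

  fits-or-too-large : ∀ (bs : Vector ℕ k) → Fits bs ⊎ ∃ λ i → size (f i) < bs i
  fits-or-too-large bs with all? (λ i → bs i ≤? size (f i))
  ... | yes fits = inj₁ fits
  ... | no ¬fits = let i , bs≰ = ¬∀⟶∃¬ k _ (λ i → bs i ≤? size (f i)) ¬fits in inj₂ (i , ≰⇒> bs≰)

  x-sum-too-large : ∀ (bs : Vector ℕ k) i → size (f i) < bs i → sumE k (λ i → x₁↓ i (bs i)) ≡ -∞
  x-sum-too-large bs i size<bs = sumE-∞ k _ i (vacc₁-too-large (τ↓⁻ i) (bs i) size<bs)

  zU-term-too-large : ∀ bs i → size (f i) < bs i → zU-term bs ≡ -∞
  zU-term-too-large bs i size<bs = cong (val 1 +E_) (x-sum-too-large bs i size<bs)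

  zJ-term-too-large : ∀ j bs i → size (f i) < bs i → zJ-term j bs ≡ -∞
  zJ-term-too-large j bs i size<bs =
    trans (cong (val δⱼ +E_) (x-sum-too-large bs i size<bs)) (+E-∞ʳ (val δⱼ))
    where δⱼ = δ j (node k f) τ root bs

  attained-fitting : ∀ (g : Vector ℕ k → ℕ⁻∞) → (∀ bs i → size (f i) < bs i → g bs ≡ -∞) →
                     ∀ xs {z} → maxE (map g xs) ≡ val z → ∃ λ bs → bs ∈ xs × Fits bs × g bs ≡ val z
  attained-fitting g too-large xs max≡z with maxE-map-attained g xs max≡z
  ... | bs , bs∈ , g≡z with fits-or-too-large bs
  ...   | inj₁ fits          = bs , bs∈ , fits , g≡z
  ...   | inj₂ (i , size<bs) with () ← trans (sym (too-large bs i size<bs)) g≡z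

  module Realize (hyp : ChildrenRealizable (node k f) τ root) (bs : Vector ℕ k) (fits : Fits bs) where

    Y : (i : Fin k) → VSet (f i)
    Y i = proj₁ (hyp i (bs i) (fits i))

    X : Bool → VSet (node k f)
    X r = graft r Y

    card-X : ∀ r → card (X r) ≡ 𝟙 r + sum bs
    card-X r = trans (card-node (X r)) (cong (𝟙 r +_) (sum-cong-≗ λ i → proj₁ (proj₂ (hyp i (bs i) (fits i)))))

    ê : Vector ℕ k
    ê = e (X false)

    #â : ℕ
    #â = #agree (X false)

    x₁↓≡ê : ∀ i → x₁↓ i (bs i) ≡ val (ê i)
    x₁↓≡ê i = sym (proj₂ (proj₂ (proj₂ (hyp i (bs i) (fits i)))))

    x-sum≡ : sumE k (λ i → x₁↓ i (bs i)) ≡ val (sum ê)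
    x-sum≡ = trans (sumE-cong k x₁↓≡ê) (sumE-val k ê)

    #x-agree≡#â : #x-agree bs ≡ #â
    #x-agree≡#â = trans (countFin≡sum k _) (sum-cong-≗ λ i → cong 𝟙 (cong₂ _==E_ x₀↓≡d (x₁↓≡ê i)))
      where
      x₀↓≡d : ∀ {i} → x₀↓ i (bs i) ≡ val (d (X false) i)
      x₀↓≡d {i} = sym (proj₁ (proj₂ (proj₂ (hyp i (bs i) (fits i)))))

    zU-term≡ : zU-term bs ≡ val (suc (sum ê))
    zU-term≡ = cong (val 1 +E_) x-sum≡

    a : Fin 2 → ℕ
    a j = 𝟙 (not (#â ≥T decJ j (τ root))) + sum ê

    zJ-term≡ : ∀ j → zJ-term j bs ≡ val (a j)
    zJ-term≡ j = cong₂ _+E_ (cong val (trans (δ≡𝟙 j bs) (cong (λ n → 𝟙 (not (n ≥T decJ j (τ root)))) #x-agree≡#â)))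
                            x-sum≡

    a₁≤a₀ : a (suc zero) ≤ a zero
    a₁≤a₀ = +-monoˡ-≤ (sum ê) (𝟙-not-anti (≥T-dec #â (τ root)))

    a₀≤1+a₁ : a zero ≤ suc (a (suc zero))
    a₀≤1+a₁ = ≤-trans (+-monoˡ-≤ (sum ê) (𝟙≤1 _)) (s≤s (m≤n+m (sum ê) _))

    dyn-X-true : ∀ j → val (dyn (node k f) ((τ^ j) [ X true ]∞)) ≡ zU-term bs
    dyn-X-true j = trans (cong val (trans (dyn-root∈ j (X true) refl) (+-comm _ 1))) (sym zU-term≡)

    dyn-X-false : ∀ j → val (dyn (node k f) ((τ^ j) [ X false ]∞)) ≡ zJ-term j bs
    dyn-X-false j = trans (cong val (trans (dyn-root∉ j (X false) refl) (+-comm (sum ê) _))) (sym (zJ-term≡ j))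

  zJ-term₁≤zJ-term₀ : ∀ bs → zJ-term (suc zero) bs ≤E zJ-term zero bs
  zJ-term₁≤zJ-term₀ bs =
    subst₂ (λ δ₁ δ₀ → val δ₁ +E x-sum ≤E val δ₀ +E x-sum) (sym (δ≡𝟙 (suc zero) bs)) (sym (δ≡𝟙 zero bs))
           (+E-monoˡ-≤ (𝟙-not-anti (≥T-dec (#x-agree bs) (τ root))) x-sum)
    where
    x-sum = sumE k (λ i → x₁↓ i (bs i))

  zJ₁≤zJ₀ : ∀ b → Z[ (suc zero) ] b ≤E Z[ zero ] b
  zJ₁≤zJ₀ b = maxE-least (map (zJ-term (suc zero)) (comps k b)) λ y∈ → case ∈-map⁻ (zJ-term (suc zero)) y∈ of λ where
    (bs , bs∈ , refl) → ≤E-trans (zJ-term₁≤zJ-term₀ bs) (zJ-upper zero b bs (comps-sound k b bs∈))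

  module _ (hyp : ChildrenRealizable (node k f) τ root) where

    zU-term≤vacc₁ : ∀ j b bs → bs ∈ comps k b → zU-term bs ≤E vacc₁ (node k f) (τ^ j) (suc b)
    zU-term≤vacc₁ j b bs bs∈ with fits-or-too-large bs
    ... | inj₂ (i , size<bs) = subst (_≤E _) (sym (zU-term-too-large bs i size<bs)) -∞≤
    ... | inj₁ fits = subst (_≤E _) (dyn-X-true j)
                        (vacc₁-upper (τ^ j) (suc b) (X true) (trans (card-X true) (cong suc (comps-sound k b bs∈))))
      where open Realize hyp bs fits

    zJ-term≤vacc₁ : ∀ j b bs → bs ∈ comps k b → zJ-term j bs ≤E vacc₁ (node k f) (τ^ j) b
    zJ-term≤vacc₁ j b bs bs∈ with fits-or-too-large bs
    ... | inj₂ (i , size<bs) = subst (_≤E _) (sym (zJ-term-too-large j bs i size<bs)) -∞≤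
    ... | inj₁ fits = subst (_≤E _) (dyn-X-false j)
                        (vacc₁-upper (τ^ j) b (X false) (trans (card-X false) (comps-sound k b bs∈)))
      where open Realize hyp bs fits

    zU⊔zJ≤vacc₁ : ∀ j b → Z b ⊔E Z[ j ] b ≤E vacc₁ (node k f) (τ^ j) b
    zU⊔zJ≤vacc₁ j b = ⊔E-least (maxE-least _ (zU-bound b)) (maxE-least _ zJ-bound)
      where
      zU-bound : ∀ b {y} → y ∈ map zU-term (compsPred k b) → y ≤E vacc₁ (node k f) (τ^ j) b
      zU-bound (suc b′) y∈ with ∈-map⁻ zU-term y∈
      ... | bs , bs∈ , refl = zU-term≤vacc₁ j b′ bs bs∈
      zJ-bound : ∀ {y} → y ∈ map (zJ-term j) (comps k b) → y ≤E vacc₁ (node k f) (τ^ j) b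
      zJ-bound y∈ with ∈-map⁻ (zJ-term j) y∈
      ... | bs , bs∈ , refl = zJ-term≤vacc₁ j b bs bs∈

    recurrence : ∀ b → Recurrence (node k f) τ root b
    recurrence b j =
      trans (xj≡vacc₁ j b) (≤E-antisym (vacc₁-least (τ^ j) b (dyn≤zU⊔zJ j b)) (zU⊔zJ≤vacc₁ j b))

    realizable-root∈ : ∀ b bs → bs ∈ comps k b → Fits bs →
                       (∀ j → zU-term bs ≡ Z (suc b) ⊔E Z[ j ] (suc b)) →
                       Realizable (node k f) τ root (suc b)
    realizable-root∈ b bs bs∈ fits attains =
      X true , trans (card-X true) (cong suc (comps-sound k b bs∈)) , realizes zero , realizes (suc zero)
      where
      open Realize hyp bs fits
      realizes : ∀ j → val (dyn (node k f) ((τ^ j) [ X true ]∞)) ≡ xj j (node k f) τ root (suc b)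
      realizes j = trans (dyn-X-true j) (trans (attains j) (sym (recurrence (suc b) j)))

    realizable-root∉ : ∀ b bs → bs ∈ comps k b → Fits bs →
                       (∀ j → zJ-term j bs ≡ Z b ⊔E Z[ j ] b) →
                       Realizable (node k f) τ root b
    realizable-root∉ b bs bs∈ fits attains =
      X false , trans (card-X false) (comps-sound k b bs∈) , realizes zero , realizes (suc zero)
      where
      open Realize hyp bs fits
      realizes : ∀ j → val (dyn (node k f) ((τ^ j) [ X false ]∞)) ≡ xj j (node k f) τ root b
      realizes j = trans (dyn-X-false j) (trans (attains j) (sym (recurrence b j)))

    realizable-zU : ∀ b {z} → Z b ≡ val z → Z[ zero ] b ≤E Z b → Realizable (node k f) τ root b
    realizable-zU zero    () _
    realizable-zU (suc b) Z≡z Z₀≤Z with attained-fitting zU-term zU-term-too-large (comps k b) Z≡z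
    ... | bs , bs∈ , fits , t≡z = realizable-root∈ b bs bs∈ fits attains
      where
      attains : ∀ j → zU-term bs ≡ Z (suc b) ⊔E Z[ j ] (suc b)
      attains zero       = trans t≡z (trans (sym Z≡z) (sym (⊔E-absorbˡ Z₀≤Z)))
      attains (suc zero) = trans t≡z (trans (sym Z≡z) (sym (⊔E-absorbˡ (≤E-trans (zJ₁≤zJ₀ (suc b)) Z₀≤Z))))

    Maximiser : Fin 2 → ℕ → ℕ → Vector ℕ k → Set
    Maximiser j b z bs = bs ∈ comps k b × Fits bs × zJ-term j bs ≡ val z

    realizable-zJ-at : ∀ b {z₀ z₁ bs} → Z[ zero ] b ≡ val z₀ → Z[ suc zero ] b ≡ val z₁ → Z b <E val z₀ →
                       Maximiser zero b z₀ bs → zJ-term (suc zero) bs ≡ val z₁ → Realizable (node k f) τ root b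
    realizable-zJ-at b {z₀} {z₁} {bs} Z₀≡z₀ Z₁≡z₁ Z<z₀ (bs∈ , fits , t₀≡z₀) t₁≡z₁ =
      realizable-root∉ b bs bs∈ fits attains
      where
      open Realize hyp bs fits
      z₀≤1+z₁ : z₀ ≤ suc z₁
      z₀≤1+z₁ = subst₂ (λ m n → m ≤ suc n) (val-injective (trans (sym (zJ-term≡ zero)) t₀≡z₀))
                       (val-injective (trans (sym (zJ-term≡ (suc zero))) t₁≡z₁)) a₀≤1+a₁
      Z≤Z₀ : Z b ≤E Z[ zero ] b
      Z≤Z₀ = subst (Z b ≤E_) (sym Z₀≡z₀) (<E⇒≤E Z<z₀)
      Z≤Z₁ : Z b ≤E Z[ suc zero ] b
      Z≤Z₁ = subst (Z b ≤E_) (sym Z₁≡z₁) (<E-val-pred Z<z₀ z₀≤1+z₁)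
      attains : ∀ j → zJ-term j bs ≡ Z b ⊔E Z[ j ] b
      attains zero       = trans t₀≡z₀ (trans (sym Z₀≡z₀) (sym (⊔E-absorbʳ Z≤Z₀)))
      attains (suc zero) = trans t₁≡z₁ (trans (sym Z₁≡z₁) (sym (⊔E-absorbʳ Z≤Z₁)))

    a-bounded : ∀ j b {z bs} → Z[ j ] b ≡ val z → bs ∈ comps k b → (fits : Fits bs) →
                Realize.a hyp bs fits j ≤ z
    a-bounded j b Zj≡z bs∈ fits
      with val≤E⁻ (subst₂ _≤E_ (Realize.zJ-term≡ hyp _ fits j) Zj≡z (zJ-upper j b _ (comps-sound k b bs∈)))
    ... | _ , refl , a≤z = a≤z

    realizable-from-maximisers : ∀ b {z₀ z₁ bs₀ bs₁} → Z[ zero ] b ≡ val z₀ → Z[ suc zero ] b ≡ val z₁ →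
                                 Z b <E val z₀ → Maximiser zero b z₀ bs₀ → Maximiser (suc zero) b z₁ bs₁ →
                                 Realizable (node k f) τ root b
    realizable-from-maximisers b {z₀} {z₁} {bs₀} {bs₁} Z₀≡z₀ Z₁≡z₁ Z<z₀
                               max₀@(bs₀∈ , fits₀ , t₀≡z₀) (bs₁∈ , fits₁ , t₁≡z₁) =
      [ (λ p₁≡z₀ → realizable-zJ-at b Z₀≡z₀ Z₁≡z₁ Z<z₀ (bs₁∈ , fits₁ , trans (R₁.zJ-term≡ zero) (cong val p₁≡z₀)) t₁≡z₁)
      , (λ q₀≡z₁ → realizable-zJ-at b Z₀≡z₀ Z₁≡z₁ Z<z₀ max₀ (trans (R₀.zJ-term≡ (suc zero)) (cong val q₀≡z₁)))
      ]′ (exchange p₁≤z₀ q₀≤z₁ z₀≤1+q₀ z₁≤p₁)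
      where
      module R₀ = Realize hyp bs₀ fits₀
      module R₁ = Realize hyp bs₁ fits₁
      p₁≤z₀ : R₁.a zero ≤ z₀
      p₁≤z₀ = a-bounded zero b Z₀≡z₀ bs₁∈ fits₁
      q₀≤z₁ : R₀.a (suc zero) ≤ z₁
      q₀≤z₁ = a-bounded (suc zero) b Z₁≡z₁ bs₀∈ fits₀
      z₀≤1+q₀ : z₀ ≤ suc (R₀.a (suc zero))
      z₀≤1+q₀ = subst (_≤ _) (val-injective (trans (sym (R₀.zJ-term≡ zero)) t₀≡z₀)) R₀.a₀≤1+a₁
      z₁≤p₁ : z₁ ≤ R₁.a zero
      z₁≤p₁ = subst (_≤ _) (val-injective (trans (sym (R₁.zJ-term≡ (suc zero))) t₁≡z₁)) R₁.a₁≤a₀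

    realizable-zJ : ∀ b {z₀} → Z[ zero ] b ≡ val z₀ → Z b <E val z₀ → Realizable (node k f) τ root b
    realizable-zJ b Z₀≡z₀ Z<z₀
      with attained-fitting (zJ-term zero) (zJ-term-too-large zero) (comps k b) Z₀≡z₀
    ... | bs₀ , max₀@(bs₀∈ , fits₀ , _)
      with val≤E⁻ (subst (_≤E _) (Realize.zJ-term≡ hyp bs₀ fits₀ (suc zero))
                                 (zJ-upper (suc zero) b bs₀ (comps-sound k b bs₀∈)))
    ... | _ , Z₁≡z₁ , _
      with attained-fitting (zJ-term (suc zero)) (zJ-term-too-large (suc zero)) (comps k b) Z₁≡z₁
    ... | _ , max₁ = realizable-from-maximisers b Z₀≡z₀ Z₁≡z₁ Z<z₀ max₀ max₁

    some-z-finite : ∀ b → b ≤ size (node k f) → (∃ λ z → Z b ≡ val z) ⊎ (∃ λ z → Z[ zero ] b ≡ val z)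
    some-z-finite b b≤size with b ≤? ∑[ i < k ] size (f i)
    ... | yes b≤∑ =
      let bs , fits , sum≡b = composition-below k (λ i → size (f i)) b b≤∑
          z , Z₀≡z , _ = val≤E⁻ (subst (_≤E _) (Realize.zJ-term≡ hyp bs fits zero) (zJ-upper zero b bs sum≡b))
      in inj₂ (z , Z₀≡z)
    ... | no b≰∑ =
      let z , Z≡z , _ = val≤E⁻ (subst₂ _≤E_ (Realize.zU-term≡ hyp (λ i → size (f i)) (λ _ → ≤-refl))
                                            (cong Z (sym b≡1+∑)) (zU-upper _ (λ i → size (f i)) refl))
      in inj₁ (z , Z≡z)
      where
      b≡1+∑ : b ≡ suc (∑[ i < k ] size (f i))
      b≡1+∑ = ≤-antisym (subst (b ≤_) (size-node k f) b≤size) (≰⇒> b≰∑)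

    realizable : ∀ b → b ≤ size (node k f) → Realizable (node k f) τ root b
    realizable b b≤size with ≤E-or->E (Z b) (Z[ zero ] b)
    ... | inj₂ Z<Z₀ = let _ , Z₀≡z₀ = <E-val⁻ Z<Z₀ in realizable-zJ b Z₀≡z₀ (subst (Z b <E_) Z₀≡z₀ Z<Z₀)
    ... | inj₁ Z₀≤Z with some-z-finite b b≤size
    ...   | inj₁ (_ , Z≡z)  = realizable-zU b Z≡z Z₀≤Z
    ...   | inj₂ (_ , Z₀≡z) =
      let _ , Z≡z , _ = val≤E⁻ (subst (_≤E Z b) Z₀≡z Z₀≤Z) in realizable-zU b Z≡z Z₀≤Z

-- Vertices below the root

module AtChild {k : ℕ} {f : Fin k → Tree} (τ : Threshold (node k f)) (j : Fin k) where

  τ′ : Threshold (f j)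
  τ′ = τ ∘ child j

  decAt-child-restrict : ∀ K → restrict (child j K) (decAt (child j K) τ) ≗ restrict K (decAt K τ′)
  decAt-child-restrict K q = decAt-child τ j K (ext K q)

  x₁-child : ∀ K b → x₁ (node k f) τ (child j K) b ≡ x₁ (f j) τ′ K b
  x₁-child K b = vacc₁-cong b (decAt-child-restrict K)

  dyn₁-child : ∀ K X → dyn (sub (f j) K) ((restrict (child j K) (decAt (child j K) τ)) [ X ]∞)
                     ≡ dyn (sub (f j) K) ((restrict K (decAt K τ′)) [ X ]∞)
  dyn₁-child K X = dyn-cong λ q → cong (λ θ → if X q then ∞ else θ) (decAt-child-restrict K q)

  realizes⁺ : ∀ K b X → Realizes (f j) τ′ K b X → Realizes (node k f) τ (child j K) b X
  realizes⁺ K b X (cardX , dyn₀ , dyn₁) =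
    cardX , dyn₀ , trans (cong val (dyn₁-child K X)) (trans dyn₁ (sym (x₁-child K b)))

  realizes⁻ : ∀ K b X → Realizes (node k f) τ (child j K) b X → Realizes (f j) τ′ K b X
  realizes⁻ K b X (cardX , dyn₀ , dyn₁) =
    cardX , dyn₀ , trans (cong val (sym (dyn₁-child K X))) (trans dyn₁ (x₁-child K b))

  childrenRealizable⁻ : ∀ p → ChildrenRealizable (node k f) τ (child j p) → ChildrenRealizable (f j) τ′ p
  childrenRealizable⁻ p hyp i bᵢ bᵢ≤ =
    let X , X-realizes = hyp i bᵢ bᵢ≤ in X , realizes⁻ (kids (f j) p i) bᵢ X X-realizes

  module _ (p : Pos (f j)) (b : ℕ) where

    m : ℕ
    m = nch (sub (f j) p)

    v : Fin m → Pos (f j)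
    v = kids (f j) p

    x-sum-child : ∀ (bs : Vector ℕ m) → sumE m (λ i → x₁ (node k f) τ (child j (v i)) (bs i))
                                      ≡ sumE m (λ i → x₁ (f j) τ′ (v i) (bs i))
    x-sum-child bs = sumE-cong m λ i → x₁-child (v i) (bs i)

    δ-child : ∀ j′ (bs : Vector ℕ m) → δ j′ (node k f) τ (child j p) bs ≡ δ j′ (f j) τ′ p bs
    δ-child j′ bs = cong (λ n → if n ≥T decJ j′ (τ′ p) then 0 else 1)
                         (length-filterᵇ-cong (λ i → cong (x₀ (f j) τ′ (v i) (bs i) ==E_) (x₁-child (v i) (bs i)))
                                              (allFin m))

    zU-child : zU (node k f) τ (child j p) b ≡ zU (f j) τ′ p b
    zU-child = cong maxE (map-cong (λ (bs : Vector ℕ m) → cong (val 1 +E_) (x-sum-child bs)) (compsPred m b))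

    zJ-child : ∀ j′ → zJ j′ (node k f) τ (child j p) b ≡ zJ j′ (f j) τ′ p b
    zJ-child j′ = cong maxE (map-cong (λ (bs : Vector ℕ m) → cong₂ _+E_ (cong val (δ-child j′ bs)) (x-sum-child bs))
                                      (comps m b))

    xj-child : ∀ j′ → xj j′ (node k f) τ (child j p) b ≡ xj j′ (f j) τ′ p b
    xj-child zero       = refl
    xj-child (suc zero) = x₁-child p b

    recurrence⁺ : Recurrence (f j) τ′ p b → Recurrence (node k f) τ (child j p) b
    recurrence⁺ rec j′ = trans (xj-child j′) (trans (rec j′) (sym (cong₂ _⊔E_ zU-child (zJ-child j′))))

    realizable⁺ : Realizable (f j) τ′ p b → Realizable (node k f) τ (child j p) b
    realizable⁺ (X , X-realizes) = X , realizes⁺ p b X X-realizes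

lemma3 : (T : Tree) (τ : Threshold T) (u : Pos T) (b : ℕ) →
    1 ≤ nch (sub T u) →
    ((i : Fin (nch (sub T u))) (bᵢ : ℕ) → bᵢ ≤ size (sub T (kids T u i)) →
      Σ (VSet (sub T (kids T u i))) λ X →
        card X ≡ bᵢ
        × val (dyn (sub T (kids T u i)) ((restrict (kids T u i) τ) [ X ]∞)) ≡ x₀ T τ (kids T u i) bᵢ
        × val (dyn (sub T (kids T u i)) ((restrict (kids T u i) (decAt (kids T u i) τ)) [ X ]∞)) ≡ x₁ T τ (kids T u i) bᵢ) →
    ((j : Fin 2) → xj j T τ u b ≡ (zU T τ u b ⊔E zJ j T τ u b))
    × (b ≤ size (sub T u) →
      Σ (VSet (sub T u)) λ X →
        card X ≡ b
        × val (dyn (sub T u) ((restrict u τ) [ X ]∞)) ≡ x₀ T τ u b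
        × val (dyn (sub T u) ((restrict u (decAt u τ)) [ X ]∞)) ≡ x₁ T τ u b)
lemma3 (node k f) τ root        b _        hyp = AtRoot.recurrence τ hyp b , AtRoot.realizable τ hyp b
lemma3 (node k f) τ (child j p) b non-leaf hyp =
  let recurrence , realizable = lemma3 (f j) (τ ∘ child j) p b non-leaf (childrenRealizable⁻ p hyp)
  in recurrence⁺ p b recurrence , realizable⁺ p b ∘ realizable
  where open AtChild τ j
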